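{- For all positive integers $m,n$, the complete bipartite graph $K_{m,n}$ is not CNSL-hyperenergetic, i.e. $LE^+_{CN}(K_{m,n})\le LE^+_{CN}(K_{m+n})$.
   Context: For a finite simple graph $\mathcal{G}$ on vertices $v_1,\dots,v_p$: $\mathrm{CN}(\mathcal{G})$ has $(i,j)$-entry $|N(v_i)\cap N(v_j)|$ for $i\neq j$ (open neighbourhoods) and $0$ on the diagonal; $\mathrm{CNRS}(\mathcal{G})$ is the diagonal matrix of row sums of $\mathrm{CN}(\mathcal{G})$; $\mathrm{CNSL}(\mathcal{G})=\mathrm{CNRS}(\mathcal{G})+\mathrm{CN}(\mathcal{G})$. $LE^+_{CN}(\mathcal{G})=\sum_\sigma|\sigma-tr(\mathrm{CNRS}(\mathcal{G}))/p|$ over the eigenvalues $\sigma$ of $\mathrm{CNSL}(\mathcal{G})$ with multiplicity. $\mathcal{G}$ on $p$ vertices is CNSL-hyperenergetic if $LE^+_{CN}(\mathcal{G})>LE^+_{CN}(K_p)$. -}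

module Defs where

open import Data.Bool using (Bool; true; false; not; _∧_; _xor_; if_then_else_)
open import Data.Nat as ℕ using (ℕ; zero; suc; _<ᵇ_)
open import Data.Fin using (Fin; zero; suc; toℕ; _≟_)
open import Data.Integer using (+_)
open import Data.Rational using (ℚ; 0ℚ; _+_; _*_; _-_; ∣_∣; _/_; _≤_)
open import Relation.Nullary using (does; yes; no)
open import Relation.Binary.PropositionalEquality using (_≡_; refl; sym)

record Graph (p : ℕ) : Set where
  field
    adj    : Fin p → Fin p → Bool
    adj-sym    : ∀ i j → adj i j ≡ adj j i
    adj-irrefl : ∀ i → adj i i ≡ false
open Graph public

Σℕ : (p : ℕ) → (Fin p → ℕ) → ℕ
Σℕ zero    f = 0
Σℕ (suc p) f = f zero ℕ.+ Σℕ p (λ i → f (suc i))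

Σℚ : (p : ℕ) → (Fin p → ℚ) → ℚ
Σℚ zero    f = 0ℚ
Σℚ (suc p) f = f zero + Σℚ p (λ i → f (suc i))

toℚ : ℕ → ℚ
toℚ n = (+ n) / 1

bit : Bool → ℕ
bit true  = 1
bit false = 0

Matrix : ℕ → Set
Matrix p = Fin p → Fin p → ℚ

commonNbrs : {p : ℕ} → Graph p → Fin p → Fin p → ℕ
commonNbrs {p} G i j = Σℕ p (λ k → bit (adj G i k ∧ adj G j k))

CNℕ : {p : ℕ} → Graph p → Fin p → Fin p → ℕ
CNℕ G i j = if does (i ≟ j) then 0 else commonNbrs G i j

rowSum : {p : ℕ} → Graph p → Fin p → ℕ
rowSum {p} G i = Σℕ p (λ j → CNℕ G i j)

CN : {p : ℕ} → Graph p → Matrix p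
CN G i j = toℚ (CNℕ G i j)

CNRS : {p : ℕ} → Graph p → Matrix p
CNRS G i j = if does (i ≟ j) then toℚ (rowSum G i) else 0ℚ

CNSL : {p : ℕ} → Graph p → Matrix p
CNSL G i j = CNRS G i j + CN G i j

trCNRS : {p : ℕ} → Graph p → ℚ
trCNRS {p} G = Σℚ p (λ i → CNRS G i i)

-- tr(CNRS(G)) / p   (p = 0 never occurs in the statement)
meanTr : {p : ℕ} → Graph p → ℚ
meanTr {zero}  G = 0ℚ
meanTr {suc q} G = trCNRS G * ((+ 1) / suc q)

-- Eigenvalues with multiplicity.
-- σ : Fin p → ℚ lists p eigenvalues, V k is an eigenvector for σ k, and
-- the p vectors V 0 … V (p-1) are linearly independent (hence a basis of
-- ℚ^p).  Then σ is exactly the spectrum of M counted with multiplicity.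

mulVec : {p : ℕ} → Matrix p → (Fin p → ℚ) → Fin p → ℚ
mulVec {p} M v i = Σℚ p (λ j → M i j * v j)

LinIndep : {p : ℕ} → (Fin p → Fin p → ℚ) → Set
LinIndep {p} V =
  (c : Fin p → ℚ) → (∀ i → Σℚ p (λ k → c k * V k i) ≡ 0ℚ) → ∀ k → c k ≡ 0ℚ

record IsEigenbasis {p : ℕ} (M : Matrix p) (σ : Fin p → ℚ)
                    (V : Fin p → Fin p → ℚ) : Set where
  field
    eigen  : ∀ k i → mulVec M (V k) i ≡ σ k * V k i
    indep  : LinIndep V
open IsEigenbasis public

LEplus : {p : ℕ} → Graph p → (Fin p → ℚ) → ℚ
LEplus {p} G σ = Σℚ p (λ k → ∣ σ k - meanTr G ∣)

neq : {p : ℕ} → Fin p → Fin p → Bool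
neq i j = if does (i ≟ j) then false else true

neq-sym : {p : ℕ} → (i j : Fin p) → neq i j ≡ neq j i
neq-sym i j with i ≟ j | j ≟ i
... | yes _ | yes _ = refl
... | no _  | no _  = refl
... | yes refl | no ¬q = Data.Empty.⊥-elim (¬q refl)
  where import Data.Empty
... | no ¬p | yes refl = Data.Empty.⊥-elim (¬p refl)
  where import Data.Empty

neq-irrefl : {p : ℕ} → (i : Fin p) → neq i i ≡ false
neq-irrefl i with i ≟ i
... | yes _ = refl
... | no ¬p = Data.Empty.⊥-elim (¬p refl)
  where import Data.Empty

K : (p : ℕ) → Graph p
K p = record { adj = neq ; adj-sym = neq-sym ; adj-irrefl = neq-irrefl }

side : {m n : ℕ} → Fin (m ℕ.+ n) → Bool
side {m} i = toℕ i <ᵇ m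

xor-comm′ : ∀ x y → x xor y ≡ y xor x
xor-comm′ true  true  = refl
xor-comm′ true  false = refl
xor-comm′ false true  = refl
xor-comm′ false false = refl

xor-self : ∀ x → x xor x ≡ false
xor-self true  = refl
xor-self false = refl

Kbip : (m n : ℕ) → Graph (m ℕ.+ n)
Kbip m n = record
  { adj        = λ i j → side {m} {n} i xor side {m} {n} j
  ; adj-sym    = λ i j → xor-comm′ (side {m} {n} i) (side {m} {n} j)
  ; adj-irrefl = λ i → xor-self (side {m} {n} i)
  }

-- On each part of K_{m,n}, and on all of K_p, the matrix CNSL acts as a rank-one
-- perturbation αI + βJ of a scalar matrix (up to a diagonal shift).  Hence every
-- eigenvalue is either the "top" value α + β·|block|, whose eigenvectors are constant on
-- the block, or the "low" value α, which needs a block with at least two vertices.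
-- Since the given eigenvectors are linearly independent, some eigenvalue of CNSL(K_p) is
-- top (otherwise all p eigenvectors would have coordinate sum 0), which gives
-- LE⁺(K_p) ≥ 2(p−1)(p−2); and at most two eigenvalues of CNSL(K_{m,n}) are top (their
-- eigenvectors are constant on both parts).  Bounding the deviations of the low and the top
-- eigenvalues of K_{m,n} separately, a polynomial case analysis in m and n (up to
-- swapping the parts) gives LE⁺(K_{m,n}) ≤ 2(p−1)(p−2) with p = m + n.

module Submission where

open import Defs

open import Data.Bool.Base using (Bool; true; false; not; _∧_; _∨_; _xor_; if_then_else_)
open import Data.Empty using (⊥-elim)
open import Data.Nat.Base using (ℕ)
open import Data.Fin.Base using (Fin; zero; suc; _↑ˡ_; _↑ʳ_)
open import Data.Fin.Properties using (_≟_)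
open import Data.Product.Base using (∃; _×_; _,_; proj₁; proj₂)
open import Data.Sum.Base as Sum using (_⊎_; inj₁; inj₂)
open import Function.Base using (_∘_)
open import Relation.Nullary using (¬_; Dec; yes; no; does)
open import Relation.Binary.PropositionalEquality

module Counting where
  open import Data.Nat.Base
  open import Data.Nat.Properties hiding (_≟_)
  open import Algebra.Properties.CommutativeSemigroup +-commutativeSemigroup using (interchange; xy∙z≈x∙zy; x∙yz≈y∙xz)

  Σℕ-cong : ∀ {p} {f g : Fin p → ℕ} → (∀ i → f i ≡ g i) → Σℕ p f ≡ Σℕ p g
  Σℕ-cong {zero}  f≗g = refl
  Σℕ-cong {suc p} f≗g = cong₂ _+_ (f≗g zero) (Σℕ-cong (f≗g ∘ suc))

  Σℕ-+ : ∀ {p} (f g : Fin p → ℕ) → Σℕ p (λ i → f i + g i) ≡ Σℕ p f + Σℕ p g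
  Σℕ-+ {zero}  f g = refl
  Σℕ-+ {suc p} f g = trans (cong (f zero + g zero +_) (Σℕ-+ (f ∘ suc) (g ∘ suc)))
                           (interchange (f zero) (g zero) _ _)

  Σℕ-*ʳ : ∀ {p} (f : Fin p → ℕ) c → Σℕ p (λ i → f i * c) ≡ Σℕ p f * c
  Σℕ-*ʳ {zero}  f c = refl
  Σℕ-*ʳ {suc p} f c = trans (cong (f zero * c +_) (Σℕ-*ʳ (f ∘ suc) c))
                            (sym (*-distribʳ-+ c (f zero) _))

  Σℕ-const : ∀ p c → Σℕ p (λ _ → c) ≡ p * c
  Σℕ-const zero    c = refl
  Σℕ-const (suc p) c = cong (c +_) (Σℕ-const p c)

  Σℕ-↑ : ∀ m n (f : Fin (m + n) → ℕ) → Σℕ (m + n) f ≡ Σℕ m (f ∘ (_↑ˡ n)) + Σℕ n (f ∘ (m ↑ʳ_))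
  Σℕ-↑ zero    n f = refl
  Σℕ-↑ (suc m) n f = trans (cong (f zero +_) (Σℕ-↑ m n (f ∘ suc))) (sym (+-assoc (f zero) _ _))

  Σℕ-replace : ∀ {p} (i : Fin p) a (f : Fin p → ℕ) →
    Σℕ p (λ j → if does (i ≟ j) then a else f j) + f i ≡ a + Σℕ p f
  Σℕ-replace {suc p} zero    a f = xy∙z≈x∙zy a (Σℕ p (f ∘ suc)) (f zero)
  Σℕ-replace {suc p} (suc i) a f = begin
    f zero + Σℕ p (λ j → if does (i ≟ j) then a else f (suc j)) + f (suc i)
      ≡⟨ +-assoc (f zero) _ (f (suc i)) ⟩
    f zero + (Σℕ p (λ j → if does (i ≟ j) then a else f (suc j)) + f (suc i))
      ≡⟨ cong (f zero +_) (Σℕ-replace i a (f ∘ suc)) ⟩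
    f zero + (a + Σℕ p (f ∘ suc))
      ≡⟨ x∙yz≈y∙xz (f zero) a (Σℕ p (f ∘ suc)) ⟩
    a + (f zero + Σℕ p (f ∘ suc)) ∎
    where open ≡-Reasoning

  m≡n+o⇒∣m-n∣≡o : ∀ {m n} o → m ≡ n + o → ∣ m - n ∣ ≡ o
  m≡n+o⇒∣m-n∣≡o {n = n} o refl = trans (∣-∣-comm (n + o) n) (∣m-m+n∣≡n n o)

  n≡m+o⇒∣m-n∣≡o : ∀ {m n} o → n ≡ m + o → ∣ m - n ∣ ≡ o
  n≡m+o⇒∣m-n∣≡o {m} o refl = ∣m-m+n∣≡n m o

  count : ∀ {p} → (Fin p → Bool) → ℕ
  count {p} S = Σℕ p (λ k → bit (S k))

  count-true : ∀ p → count {p} (λ _ → true) ≡ p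
  count-true p = trans (Σℕ-const p 1) (*-identityʳ p)

  count>0⇒witness : ∀ {p} (S : Fin p → Bool) → 0 < count S → ∃ λ k → S k ≡ true
  count>0⇒witness {suc p} S 0<count with S zero in S₀
  ... | true  = zero , S₀
  ... | false with count>0⇒witness (S ∘ suc) 0<count
  ...   | k , Sk = suc k , Sk

  witness⇒count>0 : ∀ {p} (S : Fin p → Bool) {k} → S k ≡ true → 0 < count S
  witness⇒count>0 S {zero}  Sk rewrite Sk = s≤s z≤n
  witness⇒count>0 S {suc k} Sk = ≤-trans (witness⇒count>0 (S ∘ suc) Sk) (m≤n+m _ (bit (S zero)))

  count≡1⇒unique : ∀ {p} (S : Fin p → Bool) → count S ≡ 1 →
    ∀ {i j} → S i ≡ true → S j ≡ true → i ≡ j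
  count≡1⇒unique S c≡1 {zero}  {zero}  Si Sj = refl
  count≡1⇒unique S c≡1 {zero}  {suc j} Si Sj rewrite Si =
    ⊥-elim (<-irrefl (sym (suc-injective c≡1)) (witness⇒count>0 (S ∘ suc) Sj))
  count≡1⇒unique S c≡1 {suc i} {zero}  Si Sj rewrite Sj =
    ⊥-elim (<-irrefl (sym (suc-injective c≡1)) (witness⇒count>0 (S ∘ suc) Si))
  count≡1⇒unique S c≡1 {suc i} {suc j} Si Sj with S zero in S₀
  ... | true  = ⊥-elim (<-irrefl (sym (suc-injective c≡1)) (witness⇒count>0 (S ∘ suc) Si))
  ... | false = cong suc (count≡1⇒unique (S ∘ suc) c≡1 Si Sj)

  remove : ∀ {p} → Fin p → (Fin p → Bool) → Fin p → Bool
  remove k₀ S k = if does (k₀ ≟ k) then false else S k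

  remove-self : ∀ {p} (k₀ : Fin p) S → remove k₀ S k₀ ≡ false
  remove-self k₀ S with k₀ ≟ k₀
  ... | yes _   = refl
  ... | no k≢k = ⊥-elim (k≢k refl)

  remove-other : ∀ {p} {k₀ k : Fin p} S → k₀ ≢ k → remove k₀ S k ≡ S k
  remove-other {k₀ = k₀} {k} S k₀≢k with k₀ ≟ k
  ... | yes k₀≡k = ⊥-elim (k₀≢k k₀≡k)
  ... | no _     = refl

  count-remove : ∀ {p} (S : Fin p → Bool) {k₀} → S k₀ ≡ true → count S ≡ suc (count (remove k₀ S))
  count-remove {p} S {k₀} Sk₀ = begin
    count S                                                   ≡⟨ Σℕ-replace k₀ 0 (bit ∘ S) ⟨
    Σℕ p (λ k → if does (k₀ ≟ k) then 0 else bit (S k)) + bit (S k₀) ≡⟨ cong₂ _+_ (Σℕ-cong bit-remove) (cong bit Sk₀) ⟩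
    count (remove k₀ S) + 1                                  ≡⟨ +-comm _ 1 ⟩
    suc (count (remove k₀ S))                                ∎
    where
    open ≡-Reasoning
    bit-remove : ∀ k → (if does (k₀ ≟ k) then 0 else bit (S k)) ≡ bit (remove k₀ S k)
    bit-remove k with does (k₀ ≟ k)
    ... | true  = refl
    ... | false = refl

module DeviationBudget where
  open import Data.Nat.Base
  open Counting using (m≡n+o⇒∣m-n∣≡o; n≡m+o⇒∣m-n∣≡o)
  open import Data.Nat.Properties
  open import Data.Nat.Tactic.RingSolver using (solve-∀)

  -- For K_{m,n} with m = 1 + m′ and n = 1 + n′: `order` is p, `trace` is tr CNRS, and
  -- `deviation m′ n′ v` is p·|v − tr/p|.  The part of size m has top eigenvalue
  -- topEigenvalue m′ n′ = 2(m−1)n and, when m ≥ 2, low eigenvalue (m−2)n.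
  order trace : ℕ → ℕ → ℕ
  order m′ n′ = suc m′ + suc n′
  trace m′ n′ = suc m′ * (m′ * suc n′) + suc n′ * (n′ * suc m′)

  deviation : ℕ → ℕ → ℕ → ℕ
  deviation m′ n′ v = ∣ v * order m′ n′ - trace m′ n′ ∣

  topEigenvalue : ℕ → ℕ → ℕ
  topEigenvalue m′ n′ = 2 * m′ * suc n′

  -- LE⁺(K_p) = 2(p−1)(p−2) for p = q + 2.
  completeEnergy : ℕ → ℕ
  completeEnergy q = 2 * suc q * q

  deviation-swap : ∀ m′ n′ v → deviation m′ n′ v ≡ deviation n′ m′ v
  deviation-swap m′ n′ v = cong₂ (λ p t → ∣ v * p - t ∣) (+-comm (suc m′) (suc n′))
                                                   (+-comm (suc m′ * (m′ * suc n′)) (suc n′ * (n′ * suc m′)))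

  private
    deviation-above : ∀ m′ n′ v d → v * order m′ n′ ≡ trace m′ n′ + d → deviation m′ n′ v ≡ d
    deviation-above m′ n′ v d = m≡n+o⇒∣m-n∣≡o d

    deviation-below : ∀ m′ n′ v d → trace m′ n′ ≡ v * order m′ n′ + d → deviation m′ n′ v ≡ d
    deviation-below m′ n′ v d = n≡m+o⇒∣m-n∣≡o d

    bounded-by : ∀ {x d y} s → x ≡ d → d + s ≡ y → x ≤ y
    bounded-by {x} s refl refl = m≤m+n x s

  deviation-top : ∀ a n′ →
    deviation (suc a) n′ (topEigenvalue (suc a) n′) ≡ suc n′ * ((2 + a) * (2 + a) + a * suc n′)
  deviation-top a n′ = deviation-above (suc a) n′ (topEigenvalue (suc a) n′) _ (identity a n′)
    where
    identity : ∀ a n′ → 2 * (1 + a) * (1 + n′) * ((2 + a) + (1 + n′))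
             ≡ (2 + a) * ((1 + a) * (1 + n′)) + (1 + n′) * (n′ * (2 + a))
               + (1 + n′) * ((2 + a) * (2 + a) + a * (1 + n′))
    identity = solve-∀

  deviation-top-singleton : ∀ n′ → deviation 0 n′ (topEigenvalue 0 n′) ≡ suc n′ * n′
  deviation-top-singleton n′ = deviation-below 0 n′ (topEigenvalue 0 n′) _ (identity n′)
    where
    identity : ∀ n′ → 1 * (0 * (1 + n′)) + (1 + n′) * (n′ * 1)
             ≡ 2 * 0 * (1 + n′) * (1 + (1 + n′)) + (1 + n′) * n′
    identity = solve-∀

  deviation-low : ∀ a n′ → deviation (suc a) n′ (a * suc n′) ≡ 2 * suc n′ * suc n′
  deviation-low a n′ = deviation-below (suc a) n′ (a * suc n′) _ (identity a n′)
    where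
    identity : ∀ a n′ → (2 + a) * ((1 + a) * (1 + n′)) + (1 + n′) * (n′ * (2 + a))
             ≡ a * (1 + n′) * ((2 + a) + (1 + n′)) + 2 * (1 + n′) * (1 + n′)
    identity = solve-∀

  -- At most two eigenvalues are top, so LE⁺(K_{m,n}) ≤ (p·base + 2·extra)/p.
  record Budget (m′ n′ : ℕ) : Set where
    field
      base extra : ℕ
      top-A : deviation m′ n′ (topEigenvalue m′ n′) ≤ base + extra
      top-B : deviation m′ n′ (topEigenvalue n′ m′) ≤ base + extra
      low-A : ∀ {a} → m′ ≡ suc a → deviation m′ n′ (a * suc n′) ≤ base
      low-B : ∀ {b} → n′ ≡ suc b → deviation m′ n′ (b * suc m′) ≤ base
      total : order m′ n′ * base + 2 * extra ≤ order m′ n′ * completeEnergy (m′ + n′)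

  budget-swap : ∀ {m′ n′} → Budget m′ n′ → Budget n′ m′
  budget-swap {m′} {n′} B = record
    { base  = base
    ; extra = extra
    ; top-A = subst (_≤ base + extra) (deviation-swap m′ n′ (topEigenvalue n′ m′)) top-B
    ; top-B = subst (_≤ base + extra) (deviation-swap m′ n′ (topEigenvalue m′ n′)) top-A
    ; low-A = λ {a} eq → subst (_≤ base) (deviation-swap m′ n′ (a * suc m′)) (low-B eq)
    ; low-B = λ {b} eq → subst (_≤ base) (deviation-swap m′ n′ (b * suc n′)) (low-A eq)
    ; total = subst₂ (λ p q → p * base + 2 * extra ≤ p * completeEnergy q)
                     (+-comm (suc m′) (suc n′)) (+-comm m′ n′) total
    }
    where open Budget B

  budget-K₂ : Budget 0 0
  budget-K₂ = record
    { base = 0 ; extra = 0 ; top-A = z≤n ; top-B = z≤n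
    ; low-A = λ () ; low-B = λ () ; total = z≤n }

  budget-star : ∀ b → Budget 0 (suc b)
  budget-star b = record
    { base  = 2
    ; extra = 2 + b * (5 + b)
    ; top-A = bounded-by (2 * b + 2) (deviation-top-singleton (suc b)) (top-A-slack b)
    ; top-B = bounded-by 0 (trans (deviation-swap 0 (suc b) (topEigenvalue (suc b) 0)) (deviation-top b 0)) (top-B-slack b)
    ; low-A = λ ()
    ; low-B = λ { refl → ≤-reflexive (trans (deviation-swap 0 (suc b) (b * 1)) (deviation-low b 0)) }
    ; total = bounded-by _ refl (total-slack b)
    }
    where
    top-A-slack : ∀ b → (2 + b) * (1 + b) + (2 * b + 2) ≡ 2 + (2 + b * (5 + b))
    top-A-slack = solve-∀
    top-B-slack : ∀ b → 1 * ((2 + b) * (2 + b) + b * 1) + 0 ≡ 2 + (2 + b * (5 + b))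
    top-B-slack = solve-∀
    total-slack : ∀ b → (1 + (2 + b)) * 2 + 2 * (2 + b * (5 + b)) + (2 * b * b * b + 10 * b * b + 10 * b + 2)
                ≡ (1 + (2 + b)) * (2 * (2 + b) * (1 + b))
    total-slack = solve-∀

  budget-balanced : ∀ a c → Budget (suc a) (suc (a + c))
  budget-balanced a c = record
    { base  = 2 * (2 + a + c) * (2 + a + c)
    ; extra = (2 + a) * (2 + a) * (a + c) + (2 + a + c) * (2 + a + c) * a
    ; top-A = bounded-by (2 * c * (4 + 2 * a + c)) (deviation-top a (suc (a + c))) (top-A-slack a c)
    ; top-B = bounded-by 0 (trans (deviation-swap (suc a) (suc (a + c)) (topEigenvalue (suc (a + c)) (suc a)))
                                   (deviation-top (a + c) (suc a)))
                            (top-B-slack a c)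
    ; low-A = λ { refl → ≤-reflexive (deviation-low a (suc (a + c))) }
    ; low-B = λ { refl → bounded-by (2 * c * (4 + 2 * a + c))
                           (trans (deviation-swap (suc a) (suc (a + c)) ((a + c) * suc (suc a)))
                                  (deviation-low (a + c) (suc a)))
                           (low-B-slack a c) }
    ; total = bounded-by (8 * a * a * a + 8 * a * a * c + 32 * a * a + 2 * a * c * c + 16 * a * c
                          + 40 * a + 2 * c * c + 4 * c + 16) refl (total-slack a c)
    }
    where
    top-A-slack : ∀ a c → (2 + a + c) * ((2 + a) * (2 + a) + a * (2 + a + c)) + 2 * c * (4 + 2 * a + c)
                ≡ 2 * (2 + a + c) * (2 + a + c) + ((2 + a) * (2 + a) * (a + c) + (2 + a + c) * (2 + a + c) * a)
    top-A-slack = solve-∀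
    top-B-slack : ∀ a c → (2 + a) * ((2 + a + c) * (2 + a + c) + (a + c) * (2 + a)) + 0
                ≡ 2 * (2 + a + c) * (2 + a + c) + ((2 + a) * (2 + a) * (a + c) + (2 + a + c) * (2 + a + c) * a)
    top-B-slack = solve-∀
    low-B-slack : ∀ a c → 2 * (2 + a) * (2 + a) + 2 * c * (4 + 2 * a + c) ≡ 2 * (2 + a + c) * (2 + a + c)
    low-B-slack = solve-∀
    total-slack : ∀ a c →
        ((2 + a) + (2 + a + c)) * (2 * (2 + a + c) * (2 + a + c))
        + 2 * ((2 + a) * (2 + a) * (a + c) + (2 + a + c) * (2 + a + c) * a)
        + (8 * a * a * a + 8 * a * a * c + 32 * a * a + 2 * a * c * c + 16 * a * c + 40 * a + 2 * c * c + 4 * c + 16)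
      ≡ ((2 + a) + (2 + a + c)) * (2 * (1 + ((1 + a) + (1 + a + c))) * ((1 + a) + (1 + a + c)))
    total-slack = solve-∀

  budget : ∀ m′ n′ → Budget m′ n′
  budget zero    zero    = budget-K₂
  budget zero    (suc b) = budget-star b
  budget (suc a) zero    = budget-swap (budget-star a)
  budget (suc a) (suc b) with ≤-total a b
  ... | inj₁ a≤b with m≤n⇒∃[o]m+o≡n a≤b
  ...   | c , refl = budget-balanced a c
  budget (suc a) (suc b) | inj₂ b≤a with m≤n⇒∃[o]m+o≡n b≤a
  ...   | c , refl = budget-swap (budget-balanced b c)

module Rationals where
  open import Data.Nat.Base as ℕ using (ℕ; zero; suc)
  import Data.Nat.Properties as ℕ
  import Data.Integer.Base as ℤ
  import Data.Integer.Properties as ℤ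
  open import Data.Rational.Base
    using (ℚ; 0ℚ; 1ℚ; _+_; _*_; _-_; -_; ∣_∣; _/_; _≤_; toℚᵘ; 1/_; ≢-nonZero)
  import Data.Rational.Properties as ℚ
  import Data.Rational.Unnormalised.Base as ℚᵘ
  import Data.Rational.Unnormalised.Properties as ℚᵘ
  open import Data.Rational.Solver using (module +-*-Solver)
  open +-*-Solver using (solve; _:+_; _:*_; _:-_; :-_; _:=_; con)
  open import Algebra.Bundles using (CommutativeMonoid)
  open import Algebra.Properties.CommutativeSemigroup
    (CommutativeMonoid.commutativeSemigroup ℚ.+-0-commutativeMonoid) using (interchange)
  open ≡-Reasoning

  private
    toℚᵘ-toℚ : ∀ a → toℚᵘ (toℚ a) ℚᵘ.≃ ℚᵘ.mkℚᵘ (ℤ.+ a) 0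
    toℚᵘ-toℚ a = ℚ.toℚᵘ-fromℚᵘ (ℚᵘ.mkℚᵘ (ℤ.+ a) 0)

  toℚ-+ : ∀ a b → toℚ (a ℕ.+ b) ≡ toℚ a + toℚ b
  toℚ-+ a b = ℚ.toℚᵘ-injective (ℚᵘ.≃-trans (toℚᵘ-toℚ (a ℕ.+ b)) (ℚᵘ.≃-trans sum
    (ℚᵘ.≃-sym (ℚᵘ.≃-trans (ℚ.toℚᵘ-homo-+ (toℚ a) (toℚ b)) (ℚᵘ.+-cong (toℚᵘ-toℚ a) (toℚᵘ-toℚ b))))))
    where
    sum : ℚᵘ.mkℚᵘ (ℤ.+ (a ℕ.+ b)) 0 ℚᵘ.≃ ℚᵘ.mkℚᵘ (ℤ.+ a) 0 ℚᵘ.+ ℚᵘ.mkℚᵘ (ℤ.+ b) 0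
    sum = ℚᵘ.*≡* (trans (ℤ.*-identityʳ _) (sym (trans (ℤ.*-identityʳ _)
                   (cong₂ ℤ._+_ (ℤ.*-identityʳ (ℤ.+ a)) (ℤ.*-identityʳ (ℤ.+ b))))))

  toℚ-* : ∀ a b → toℚ (a ℕ.* b) ≡ toℚ a * toℚ b
  toℚ-* zero    b = sym (ℚ.*-zeroˡ (toℚ b))
  toℚ-* (suc a) b = begin
    toℚ (b ℕ.+ a ℕ.* b)         ≡⟨ trans (toℚ-+ b (a ℕ.* b)) (cong (toℚ b +_) (toℚ-* a b)) ⟩
    toℚ b + toℚ a * toℚ b       ≡⟨ solve 2 (λ x y → y :+ x :* y := (con 1ℚ :+ x) :* y) refl (toℚ a) (toℚ b) ⟩
    (1ℚ + toℚ a) * toℚ b        ≡⟨ cong (_* toℚ b) (toℚ-+ 1 a) ⟨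
    toℚ (suc a) * toℚ b         ∎

  -- meanTr of a graph on suc k vertices is its trace times recip k = 1/(k+1).
  recip : ℕ → ℚ
  recip k = ℤ.+ 1 / suc k

  suc*recip : ∀ k → toℚ (suc k) * recip k ≡ 1ℚ
  suc*recip k = ℚ.toℚᵘ-injective (ℚᵘ.≃-trans (ℚ.toℚᵘ-homo-* (toℚ (suc k)) (recip k))
    (ℚᵘ.≃-trans (ℚᵘ.*-cong (toℚᵘ-toℚ (suc k)) (ℚ.toℚᵘ-fromℚᵘ (ℚᵘ.mkℚᵘ (ℤ.+ 1) k)))
      (ℚᵘ.*≡* (units (ℤ.+ suc k)))))
    where
    units : ∀ x → (x ℤ.* ℤ.+ 1) ℤ.* ℤ.+ 1 ≡ ℤ.+ 1 ℤ.* (ℤ.+ 1 ℤ.* x)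
    units x = trans (ℤ.*-identityʳ (x ℤ.* ℤ.+ 1)) (trans (ℤ.*-identityʳ x)
                (sym (trans (ℤ.*-identityˡ (ℤ.+ 1 ℤ.* x)) (ℤ.*-identityˡ x))))

  0≤toℚ : ∀ a → 0ℚ ≤ toℚ a
  0≤toℚ a = ℚ.nonNegative⁻¹ (toℚ a) {{ℚ.normalize-nonNeg a 1}}

  0≤recip : ∀ k → 0ℚ ≤ recip k
  0≤recip k = ℚ.nonNegative⁻¹ (recip k) {{ℚ.normalize-nonNeg 1 (suc k)}}

  toℚ-mono-≤ : ∀ {a b} → a ℕ.≤ b → toℚ a ≤ toℚ b
  toℚ-mono-≤ {a} a≤b with ℕ.m≤n⇒∃[o]m+o≡n a≤b
  ... | c , refl = subst (_≤ toℚ (a ℕ.+ c)) (ℚ.+-identityʳ (toℚ a))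
                     (subst (toℚ a + 0ℚ ≤_) (sym (toℚ-+ a c)) (ℚ.+-monoʳ-≤ (toℚ a) (0≤toℚ c)))

  *recip-mono-≤ : ∀ k {a b} → a ℕ.≤ b → toℚ a * recip k ≤ toℚ b * recip k
  *recip-mono-≤ k a≤b = ℚ.*-monoʳ-≤-nonNeg (recip k) {{ℚ.normalize-nonNeg 1 (suc k)}} (toℚ-mono-≤ a≤b)

  toℚ-*-recip : ∀ k e → toℚ (suc k ℕ.* e) * recip k ≡ toℚ e
  toℚ-*-recip k e = begin
    toℚ (suc k ℕ.* e) * recip k   ≡⟨ cong (_* recip k) (trans (toℚ-* (suc k) e) (ℚ.*-comm _ (toℚ e))) ⟩
    toℚ e * toℚ (suc k) * recip k ≡⟨ ℚ.*-assoc (toℚ e) _ _ ⟩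
    toℚ e * (toℚ (suc k) * recip k) ≡⟨ cong (toℚ e *_) (suc*recip k) ⟩
    toℚ e * 1ℚ                    ≡⟨ ℚ.*-identityʳ (toℚ e) ⟩
    toℚ e                         ∎

  private
    ∣a-[a+c]∣ : ∀ a c → ∣ toℚ a - toℚ (a ℕ.+ c) ∣ ≡ toℚ c
    ∣a-[a+c]∣ a c = begin
      ∣ toℚ a - toℚ (a ℕ.+ c) ∣     ≡⟨ cong (λ x → ∣ toℚ a - x ∣) (toℚ-+ a c) ⟩
      ∣ toℚ a - (toℚ a + toℚ c) ∣   ≡⟨ cong ∣_∣ (solve 2 (λ x y → x :- (x :+ y) := :- y) refl (toℚ a) (toℚ c)) ⟩
      ∣ - toℚ c ∣                   ≡⟨ ℚ.∣-p∣≡∣p∣ (toℚ c) ⟩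
      ∣ toℚ c ∣                     ≡⟨ ℚ.0≤p⇒∣p∣≡p (0≤toℚ c) ⟩
      toℚ c                         ∎

  ∣toℚ-toℚ∣ : ∀ a b → ∣ toℚ a - toℚ b ∣ ≡ toℚ ℕ.∣ a - b ∣
  ∣toℚ-toℚ∣ a b with ℕ.≤-total a b
  ... | inj₁ a≤b with ℕ.m≤n⇒∃[o]m+o≡n a≤b
  ...   | c , refl = trans (∣a-[a+c]∣ a c) (cong toℚ (sym (ℕ.∣m-m+n∣≡n a c)))
  ∣toℚ-toℚ∣ a b | inj₂ b≤a with ℕ.m≤n⇒∃[o]m+o≡n b≤a
  ...   | c , refl = begin
    ∣ toℚ (b ℕ.+ c) - toℚ b ∣   ≡⟨ ℚ.∣-p∣≡∣p∣ _ ⟨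
    ∣ - (toℚ (b ℕ.+ c) - toℚ b) ∣ ≡⟨ cong ∣_∣ (solve 2 (λ x y → :- (x :- y) := y :- x) refl (toℚ (b ℕ.+ c)) (toℚ b)) ⟩
    ∣ toℚ b - toℚ (b ℕ.+ c) ∣   ≡⟨ ∣a-[a+c]∣ b c ⟩
    toℚ c                       ≡⟨ cong toℚ (trans (ℕ.∣-∣-comm (b ℕ.+ c) b) (ℕ.∣m-m+n∣≡n b c)) ⟨
    toℚ ℕ.∣ b ℕ.+ c - b ∣       ∎

  deviation-scaled : ∀ k v t → ∣ toℚ v - toℚ t * recip k ∣ ≡ toℚ ℕ.∣ v ℕ.* suc k - t ∣ * recip k
  deviation-scaled k v t = begin
    ∣ toℚ v - toℚ t * recip k ∣                      ≡⟨ cong (λ x → ∣ x - toℚ t * recip k ∣) (toℚ-*-recip k v) ⟨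
    ∣ toℚ (suc k ℕ.* v) * recip k - toℚ t * recip k ∣ ≡⟨ cong ∣_∣ (solve 3 (λ x y r → x :* r :- y :* r := (x :- y) :* r) refl (toℚ (suc k ℕ.* v)) (toℚ t) (recip k)) ⟩
    ∣ (toℚ (suc k ℕ.* v) - toℚ t) * recip k ∣         ≡⟨ ℚ.∣p*q∣≡∣p∣*∣q∣ (toℚ (suc k ℕ.* v) - toℚ t) (recip k) ⟩
    ∣ toℚ (suc k ℕ.* v) - toℚ t ∣ * ∣ recip k ∣       ≡⟨ cong₂ _*_ (∣toℚ-toℚ∣ (suc k ℕ.* v) t) (ℚ.0≤p⇒∣p∣≡p (0≤recip k)) ⟩
    toℚ ℕ.∣ suc k ℕ.* v - t ∣ * recip k              ≡⟨ cong (λ x → toℚ ℕ.∣ x - t ∣ * recip k) (ℕ.*-comm (suc k) v) ⟩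
    toℚ ℕ.∣ v ℕ.* suc k - t ∣ * recip k              ∎

  *-cancelʳ-≢0 : ∀ {x y} z → z ≢ 0ℚ → x * z ≡ y * z → x ≡ y
  *-cancelʳ-≢0 {x} {y} z z≢0 xz≡yz = begin
    x                 ≡⟨ undo x ⟨
    x * z * 1/ z      ≡⟨ cong (_* 1/ z) xz≡yz ⟩
    y * z * 1/ z      ≡⟨ undo y ⟩
    y                 ∎
    where
    instance _ = ≢-nonZero z≢0
    undo : ∀ w → w * z * 1/ z ≡ w
    undo w = trans (ℚ.*-assoc w z (1/ z)) (trans (cong (w *_) (ℚ.*-inverseʳ z)) (ℚ.*-identityʳ w))

  *-≢0 : ∀ {x y} → x ≢ 0ℚ → y ≢ 0ℚ → x * y ≢ 0ℚ
  *-≢0 {x} {y} x≢0 y≢0 xy≡0 = x≢0 (*-cancelʳ-≢0 y y≢0 (trans xy≡0 (sym (ℚ.*-zeroˡ y))))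

  +-cancelʳ : ∀ {x y} z → x + z ≡ y + z → x ≡ y
  +-cancelʳ {x} {y} z xz≡yz = begin
    x             ≡⟨ solve 2 (λ x z → x := x :+ z :- z) refl x z ⟩
    x + z - z     ≡⟨ cong (_- z) xz≡yz ⟩
    y + z - z     ≡⟨ solve 2 (λ y z → y :+ z :- z := y) refl y z ⟩
    y             ∎

  +-cancelʳ-toℚ : ∀ {x} a {b} v → x + toℚ a ≡ toℚ b → v ℕ.+ a ≡ b → x ≡ toℚ v
  +-cancelʳ-toℚ {x} a v x+a≡b refl = +-cancelʳ (toℚ a) (trans x+a≡b (toℚ-+ v a))

  if-0-* : ∀ b a y → (if b then a else 0ℚ) * y ≡ (if b then a * y else 0ℚ)
  if-0-* true  a y = refl
  if-0-* false a y = ℚ.*-zeroˡ y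

  p-q≡0⇒p≡q : ∀ {x y} → x - y ≡ 0ℚ → x ≡ y
  p-q≡0⇒p≡q {x} {y} x-y≡0 = begin
    x             ≡⟨ solve 2 (λ x y → x := (x :- y) :+ y) refl x y ⟩
    x - y + y     ≡⟨ cong (_+ y) x-y≡0 ⟩
    0ℚ + y        ≡⟨ ℚ.+-identityˡ y ⟩
    y             ∎

  Σℚ-cong : ∀ {p} {f g : Fin p → ℚ} → (∀ i → f i ≡ g i) → Σℚ p f ≡ Σℚ p g
  Σℚ-cong {zero}  f≗g = refl
  Σℚ-cong {suc p} f≗g = cong₂ _+_ (f≗g zero) (Σℚ-cong (f≗g ∘ suc))

  Σℚ-0 : ∀ p → Σℚ p (λ _ → 0ℚ) ≡ 0ℚ
  Σℚ-0 zero    = refl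
  Σℚ-0 (suc p) = trans (ℚ.+-identityˡ _) (Σℚ-0 p)

  Σℚ-+ : ∀ {p} (f g : Fin p → ℚ) → Σℚ p (λ i → f i + g i) ≡ Σℚ p f + Σℚ p g
  Σℚ-+ {zero}  f g = refl
  Σℚ-+ {suc p} f g = trans (cong (f zero + g zero +_) (Σℚ-+ (f ∘ suc) (g ∘ suc)))
                           (interchange (f zero) (g zero) (Σℚ p (f ∘ suc)) (Σℚ p (g ∘ suc)))

  Σℚ-*ˡ : ∀ {p} c (f : Fin p → ℚ) → Σℚ p (λ i → c * f i) ≡ c * Σℚ p f
  Σℚ-*ˡ {zero}  c f = sym (ℚ.*-zeroʳ c)
  Σℚ-*ˡ {suc p} c f = trans (cong (c * f zero +_) (Σℚ-*ˡ c (f ∘ suc))) (sym (ℚ.*-distribˡ-+ c (f zero) (Σℚ p (f ∘ suc))))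

  Σℚ-*ʳ : ∀ {p} c (f : Fin p → ℚ) → Σℚ p (λ i → f i * c) ≡ Σℚ p f * c
  Σℚ-*ʳ {zero}  c f = sym (ℚ.*-zeroˡ c)
  Σℚ-*ʳ {suc p} c f = trans (cong (f zero * c +_) (Σℚ-*ʳ c (f ∘ suc))) (sym (ℚ.*-distribʳ-+ c (f zero) (Σℚ p (f ∘ suc))))

  Σℚ-neg : ∀ {p} (f : Fin p → ℚ) → Σℚ p (λ i → - f i) ≡ - Σℚ p f
  Σℚ-neg {zero}  f = refl
  Σℚ-neg {suc p} f = trans (cong (- f zero +_) (Σℚ-neg (f ∘ suc))) (sym (ℚ.neg-distrib-+ (f zero) (Σℚ p (f ∘ suc))))

  Σℚ-swap : ∀ {p q} (f : Fin p → Fin q → ℚ) →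
    Σℚ p (λ i → Σℚ q (f i)) ≡ Σℚ q (λ j → Σℚ p (λ i → f i j))
  Σℚ-swap {zero}  {q} f = sym (Σℚ-0 q)
  Σℚ-swap {suc p} {q} f = trans (cong (Σℚ q (f zero) +_) (Σℚ-swap (f ∘ suc)))
                                (sym (Σℚ-+ (f zero) (λ j → Σℚ p (λ i → f (suc i) j))))

  Σℚ-mono-≤ : ∀ {p} {f g : Fin p → ℚ} → (∀ i → f i ≤ g i) → Σℚ p f ≤ Σℚ p g
  Σℚ-mono-≤ {zero}  f≤g = ℚ.≤-refl
  Σℚ-mono-≤ {suc p} f≤g = ℚ.+-mono-≤ (f≤g zero) (Σℚ-mono-≤ (f≤g ∘ suc))

  Σℚ-δ : ∀ {p} (i : Fin p) (f : Fin p → ℚ) → Σℚ p (λ j → if does (i ≟ j) then f j else 0ℚ) ≡ f i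
  Σℚ-δ {suc p} zero    f = trans (cong (f zero +_) (Σℚ-0 p)) (ℚ.+-identityʳ (f zero))
  Σℚ-δ {suc p} (suc i) f = trans (ℚ.+-identityˡ _) (Σℚ-δ i (f ∘ suc))

  Σℚ-offdiag : ∀ {p} (i : Fin p) (f : Fin p → ℚ) →
    Σℚ p (λ j → if does (i ≟ j) then 0ℚ else f j) + f i ≡ Σℚ p f
  Σℚ-offdiag {suc p} zero    f =
    trans (cong (_+ f zero) (ℚ.+-identityˡ (Σℚ p (f ∘ suc)))) (ℚ.+-comm (Σℚ p (f ∘ suc)) (f zero))
  Σℚ-offdiag {suc p} (suc i) f = trans (ℚ.+-assoc (f zero) _ _) (cong (f zero +_) (Σℚ-offdiag i (f ∘ suc)))

  toℚ-Σ : ∀ {p} (f : Fin p → ℕ) → toℚ (Σℕ p f) ≡ Σℚ p (toℚ ∘ f)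
  toℚ-Σ {zero}  f = refl
  toℚ-Σ {suc p} f = trans (toℚ-+ (f zero) _) (cong (toℚ (f zero) +_) (toℚ-Σ (f ∘ suc)))

module LinearDependence where
  open import Data.Nat.Base as ℕ using (zero; suc; _<_)
  import Data.Nat.Properties as ℕ
  import Data.Bool.Properties as Bool
  open import Data.Fin.Properties using (any?; ¬∀⟶∃¬)
  open import Data.Rational.Base using (ℚ; 0ℚ; 1ℚ; _+_; _*_; _-_; -_)
  import Data.Rational.Properties as ℚ
  open import Data.Rational.Solver using (module +-*-Solver)
  open +-*-Solver using (solve; _:+_; _:*_; _:-_; :-_; _:=_; con)
  open import Relation.Nullary.Decidable using (_×-dec_; ¬?)
  open Counting
  open Rationals
  open ≡-Reasoning

  SupportedOn : ∀ {p} → (Fin p → Bool) → (Fin p → ℚ) → Set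
  SupportedOn S c = ∀ k → S k ≡ false → c k ≡ 0ℚ

  IsLinearRelation : ∀ {p d} → (Fin p → ℚ) → (Fin p → Fin d → ℚ) → Set
  IsLinearRelation {p} c w = ∀ i → Σℚ p (λ k → c k * w k i) ≡ 0ℚ

  record NontrivialLinearRelation {p d} (S : Fin p → Bool) (w : Fin p → Fin d → ℚ) : Set where
    field
      coeff      : Fin p → ℚ
      supported  : SupportedOn S coeff
      witness    : Fin p
      nontrivial : coeff witness ≢ 0ℚ
      relation   : IsLinearRelation coeff w

  unit : ∀ {p} → Fin p → Fin p → ℚ
  unit k₀ k = if does (k₀ ≟ k) then 1ℚ else 0ℚ

  unit-self : ∀ {p} (k₀ : Fin p) → unit k₀ k₀ ≡ 1ℚ
  unit-self k₀ with k₀ ≟ k₀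
  ... | yes _   = refl
  ... | no k≢k = ⊥-elim (k≢k refl)

  unit-other : ∀ {p} {k₀ k : Fin p} → k₀ ≢ k → unit k₀ k ≡ 0ℚ
  unit-other {k₀ = k₀} {k} k₀≢k with k₀ ≟ k
  ... | yes k₀≡k = ⊥-elim (k₀≢k k₀≡k)
  ... | no _     = refl

  Σℚ-unit : ∀ {p} (k₀ : Fin p) (u : Fin p → ℚ) → Σℚ p (λ k → unit k₀ k * u k) ≡ u k₀
  Σℚ-unit k₀ u = trans (Σℚ-cong (λ k → if-0-* (does (k₀ ≟ k)) 1ℚ (u k)))
                       (trans (Σℚ-δ k₀ (λ k → 1ℚ * u k)) (ℚ.*-identityˡ (u k₀)))

  private
    Σℚ-combination : ∀ {p} (c u v : Fin p → ℚ) a b →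
      Σℚ p (λ k → c k * (a * u k - b * v k)) ≡ a * Σℚ p (λ k → c k * u k) - b * Σℚ p (λ k → c k * v k)
    Σℚ-combination {p} c u v a b = begin
      Σℚ p (λ k → c k * (a * u k - b * v k))
        ≡⟨ Σℚ-cong (λ k → solve 5 (λ c u v a b → c :* (a :* u :- b :* v) := a :* (c :* u) :+ :- (b :* (c :* v))) refl (c k) (u k) (v k) a b) ⟩
      Σℚ p (λ k → a * (c k * u k) + - (b * (c k * v k)))
        ≡⟨ Σℚ-+ (λ k → a * (c k * u k)) (λ k → - (b * (c k * v k))) ⟩
      Σℚ p (λ k → a * (c k * u k)) + Σℚ p (λ k → - (b * (c k * v k)))
        ≡⟨ cong₂ _+_ (Σℚ-*ˡ a (λ k → c k * u k)) (trans (Σℚ-neg (λ k → b * (c k * v k))) (cong -_ (Σℚ-*ˡ b (λ k → c k * v k)))) ⟩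
      a * Σℚ p (λ k → c k * u k) - b * Σℚ p (λ k → c k * v k) ∎

    Σℚ-shift : ∀ {p} (c : Fin p → ℚ) (k₀ : Fin p) r y (u : Fin p → ℚ) →
      Σℚ p (λ k → (r * c k + y * unit k₀ k) * u k) ≡ r * Σℚ p (λ k → c k * u k) + y * u k₀
    Σℚ-shift {p} c k₀ r y u = begin
      Σℚ p (λ k → (r * c k + y * unit k₀ k) * u k)
        ≡⟨ Σℚ-cong (λ k → solve 5 (λ r c y e u → (r :* c :+ y :* e) :* u := r :* (c :* u) :+ y :* (e :* u)) refl r (c k) y (unit k₀ k) (u k)) ⟩
      Σℚ p (λ k → r * (c k * u k) + y * (unit k₀ k * u k))
        ≡⟨ Σℚ-+ (λ k → r * (c k * u k)) (λ k → y * (unit k₀ k * u k)) ⟩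
      Σℚ p (λ k → r * (c k * u k)) + Σℚ p (λ k → y * (unit k₀ k * u k))
        ≡⟨ cong₂ _+_ (Σℚ-*ˡ r (λ k → c k * u k)) (trans (Σℚ-*ˡ y (λ k → unit k₀ k * u k)) (cong (y *_) (Σℚ-unit k₀ u))) ⟩
      r * Σℚ p (λ k → c k * u k) + y * u k₀ ∎

    first-column-zero : ∀ {p d} {S : Fin p → Bool} {w : Fin p → Fin (suc d) → ℚ} →
      (∀ k → S k ≡ true → w k zero ≡ 0ℚ) → NontrivialLinearRelation S (λ k → w k ∘ suc) → NontrivialLinearRelation S w
    first-column-zero {p} {S = S} {w} w₀≡0 R = record
      { coeff = coeff ; supported = supported ; witness = witness ; nontrivial = nontrivial ; relation = relation′ }
      where
      open NontrivialLinearRelation R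
      term₀ : ∀ k → coeff k * w k zero ≡ 0ℚ
      term₀ k with S k in Sk
      ... | true  = trans (cong (coeff k *_) (w₀≡0 k Sk)) (ℚ.*-zeroʳ (coeff k))
      ... | false = trans (cong (_* w k zero) (supported k Sk)) (ℚ.*-zeroˡ (w k zero))
      relation′ : IsLinearRelation coeff w
      relation′ zero    = trans (Σℚ-cong term₀) (Σℚ-0 p)
      relation′ (suc i) = relation i

    -- Pivoting on w k₀ zero ≠ 0 clears the first coordinate.
    eliminate : ∀ {p d} {S : Fin p → Bool} {w : Fin p → Fin (suc d) → ℚ} {k₀} →
      S k₀ ≡ true → w k₀ zero ≢ 0ℚ →
      NontrivialLinearRelation (remove k₀ S) (λ k i → w k₀ zero * w k (suc i) - w k₀ (suc i) * w k zero) →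
      NontrivialLinearRelation S w
    eliminate {p} {S = S} {w} {k₀} Sk₀ r≢0 R = record
      { coeff = c ; supported = supported′ ; witness = witness ; nontrivial = nontrivial′ ; relation = relation′ }
      where
      open NontrivialLinearRelation R renaming (coeff to c′)
      r X : ℚ
      r = w k₀ zero
      X = Σℚ p (λ k → c′ k * w k zero)
      c : Fin p → ℚ
      c k = r * c′ k + - X * unit k₀ k

      c′k₀≡0 : c′ k₀ ≡ 0ℚ
      c′k₀≡0 = supported k₀ (remove-self k₀ S)

      off-pivot : ∀ {k} → k₀ ≢ k → c k ≡ r * c′ k
      off-pivot {k} k₀≢k = trans (cong (λ e → r * c′ k + - X * e) (unit-other k₀≢k))
                                 (solve 2 (λ a x → a :+ x :* con 0ℚ := a) refl (r * c′ k) (- X))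

      supported′ : SupportedOn S c
      supported′ k Sk = by-cases (k₀ ≟ k)
        where
        by-cases : Dec (k₀ ≡ k) → c k ≡ 0ℚ
        by-cases (yes k₀≡k) = ⊥-elim (Bool.not-¬ refl (trans (sym (subst (λ j → S j ≡ true) k₀≡k Sk₀)) Sk))
        by-cases (no k₀≢k)  =
          trans (off-pivot k₀≢k) (trans (cong (r *_) (supported k (trans (remove-other S k₀≢k) Sk))) (ℚ.*-zeroʳ r))

      nontrivial′ : c witness ≢ 0ℚ
      nontrivial′ = subst (λ x → x ≢ 0ℚ) (sym (off-pivot k₀≢witness)) (*-≢0 r≢0 nontrivial)
        where
        k₀≢witness : k₀ ≢ witness
        k₀≢witness refl = nontrivial c′k₀≡0

      relation′ : IsLinearRelation c w
      relation′ zero = begin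
        Σℚ p (λ k → c k * w k zero) ≡⟨ Σℚ-shift c′ k₀ r (- X) (λ k → w k zero) ⟩
        r * X + - X * r             ≡⟨ solve 2 (λ r x → r :* x :+ :- x :* r := con 0ℚ) refl r X ⟩
        0ℚ                          ∎
      relation′ (suc i) = begin
        Σℚ p (λ k → c k * w k (suc i))  ≡⟨ Σℚ-shift c′ k₀ r (- X) (λ k → w k (suc i)) ⟩
        r * A + - X * W                 ≡⟨ solve 4 (λ r a x w → r :* a :+ :- x :* w := r :* a :- w :* x) refl r A X W ⟩
        r * A - W * X                   ≡⟨ Σℚ-combination c′ (λ k → w k (suc i)) (λ k → w k zero) r W ⟨
        Σℚ p (λ k → c′ k * (r * w k (suc i) - W * w k zero)) ≡⟨ relation i ⟩
        0ℚ                              ∎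
        where
        A W : ℚ
        A = Σℚ p (λ k → c′ k * w k (suc i))
        W = w k₀ (suc i)

  dependent : ∀ d {p} (S : Fin p → Bool) (w : Fin p → Fin d → ℚ) → d < count S → NontrivialLinearRelation S w
  dependent zero S w 0<count with count>0⇒witness S 0<count
  ... | k₀ , Sk₀ = record
    { coeff = unit k₀ ; supported = supported ; witness = k₀
    ; nontrivial = λ e → ℚ.1≢0 (trans (sym (unit-self k₀)) e) ; relation = λ () }
    where
    supported : SupportedOn S (unit k₀)
    supported k Sk with k₀ ≟ k
    ... | yes refl with trans (sym Sk₀) Sk
    ...   | ()
    supported k Sk | no _ = refl
  dependent (suc d) S w d<count with any? (λ k → (S k Bool.≟ true) ×-dec ¬? (w k zero ℚ.≟ 0ℚ))
  ... | yes (k₀ , Sk₀ , r≢0) =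
    eliminate Sk₀ r≢0 (dependent d (remove k₀ S) _ (ℕ.≤-pred (subst (suc d <_) (count-remove S Sk₀) d<count)))
  ... | no no-pivot =
    first-column-zero column₀ (dependent d S (λ k → w k ∘ suc) (ℕ.<-trans (ℕ.n<1+n d) d<count))
    where
    column₀ : ∀ k → S k ≡ true → w k zero ≡ 0ℚ
    column₀ k Sk with w k zero ℚ.≟ 0ℚ
    ... | yes w₀≡0 = w₀≡0
    ... | no w₀≢0  = ⊥-elim (no-pivot (k , Sk , w₀≢0))

  count≤dim : ∀ {p d} {V : Fin p → Fin p → ℚ} → LinIndep V → (S : Fin p → Bool) (w : Fin p → Fin d → ℚ) →
    (∀ c → SupportedOn S c → IsLinearRelation c w → IsLinearRelation c V) → count S ℕ.≤ d
  count≤dim {d = d} independent S w lift = ℕ.≮⇒≥ λ d<count →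
    let open NontrivialLinearRelation (dependent d S w d<count)
    in nontrivial (independent coeff (lift coeff supported relation) witness)

  LinIndep⇒nonzero : ∀ {p} {V : Fin p → Fin p → ℚ} → LinIndep V → ∀ k → ∃ λ i → V k i ≢ 0ℚ
  LinIndep⇒nonzero {p} {V} independent k =
    ¬∀⟶∃¬ p (λ i → V k i ≡ 0ℚ) (λ i → V k i ℚ.≟ 0ℚ) λ V≡0 →
      ℚ.1≢0 (trans (sym (unit-self k)) (independent (unit k) (λ i → trans (Σℚ-unit k (λ l → V l i)) (V≡0 i)) k))

module RankOneBlock where
  open import Data.Nat.Base as ℕ using (_<_)
  import Data.Nat.Properties as ℕ
  import Data.Bool.Properties as Bool
  open import Data.Rational.Base using (ℚ; 0ℚ; 1ℚ; _+_; _*_; _-_)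
  import Data.Rational.Properties as ℚ
  open import Data.Rational.Solver using (module +-*-Solver)
  open +-*-Solver using (solve; _:+_; _:*_; _:-_; _:=_; con)
  open Counting
  open Rationals
  open ≡-Reasoning

  blockSum : ∀ {p} → (Fin p → Bool) → (Fin p → ℚ) → ℚ
  blockSum {p} P x = Σℚ p (λ j → if P j then x j else 0ℚ)

  blockSum-ones : ∀ {p} (P : Fin p → Bool) → blockSum P (λ _ → 1ℚ) ≡ toℚ (count P)
  blockSum-ones P = trans (Σℚ-cong (λ j → indicator (P j))) (sym (toℚ-Σ (bit ∘ P)))
    where
    indicator : ∀ b → (if b then 1ℚ else 0ℚ) ≡ toℚ (bit b)
    indicator true  = refl
    indicator false = refl

  blockSum-singleton : ∀ {p} (P : Fin p → Bool) (x : Fin p → ℚ) {i} →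
    count P ≡ 1 → P i ≡ true → blockSum P x ≡ x i
  blockSum-singleton P x {i} count≡1 Pi = trans (Σℚ-cong term) (Σℚ-δ i x)
    where
    term : ∀ j → (if P j then x j else 0ℚ) ≡ (if does (i ≟ j) then x j else 0ℚ)
    term j with i ≟ j | P j in Pj
    ... | yes refl | true  = refl
    ... | yes refl | false = ⊥-elim (Bool.not-¬ refl (trans (sym Pi) Pj))
    ... | no _     | false = refl
    ... | no i≢j   | true  = ⊥-elim (i≢j (count≡1⇒unique P count≡1 Pi Pj))

  record IsBlockEigenvector {p} (P : Fin p → Bool) (x : Fin p → ℚ) (μ α β : ℚ) : Set where
    constructor block-equation
    field equation : ∀ i → P i ≡ true → μ * x i ≡ α * x i + β * blockSum P x

  module _ {p} {P : Fin p → Bool} {x : Fin p → ℚ} {μ α β : ℚ} (isEigen : IsBlockEigenvector P x μ α β) where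
    open IsBlockEigenvector isEigen

    block-trace : μ * blockSum P x ≡ (α + β * toℚ (count P)) * blockSum P x
    block-trace = begin
      μ * S                                             ≡⟨ Σℚ-*ˡ μ (λ j → if P j then x j else 0ℚ) ⟨
      Σℚ p (λ j → μ * (if P j then x j else 0ℚ))        ≡⟨ Σℚ-cong (λ j → on-block j (P j) refl) ⟩
      Σℚ p (λ j → α * (if P j then x j else 0ℚ) + β * S * (if P j then 1ℚ else 0ℚ))
        ≡⟨ Σℚ-+ (λ j → α * (if P j then x j else 0ℚ)) (λ j → β * S * (if P j then 1ℚ else 0ℚ)) ⟩
      Σℚ p (λ j → α * (if P j then x j else 0ℚ)) + Σℚ p (λ j → β * S * (if P j then 1ℚ else 0ℚ))
        ≡⟨ cong₂ _+_ (Σℚ-*ˡ α (λ j → if P j then x j else 0ℚ))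
                     (trans (Σℚ-*ˡ (β * S) (λ j → if P j then 1ℚ else 0ℚ)) (cong (β * S *_) (blockSum-ones P))) ⟩
      α * S + β * S * toℚ (count P)                     ≡⟨ solve 4 (λ a b s c → a :* s :+ b :* s :* c := (a :+ b :* c) :* s) refl α β S (toℚ (count P)) ⟩
      (α + β * toℚ (count P)) * S                       ∎
      where
      S = blockSum P x
      on-block : ∀ j b → P j ≡ b →
        μ * (if b then x j else 0ℚ) ≡ α * (if b then x j else 0ℚ) + β * S * (if b then 1ℚ else 0ℚ)
      on-block j true  Pj = trans (equation j Pj) (cong (α * x j +_) (sym (ℚ.*-identityʳ (β * S))))
      on-block j false Pj = solve 3 (λ m a b → m :* con 0ℚ := a :* con 0ℚ :+ b :* con 0ℚ) refl μ α (β * S)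

    top-or-balanced : μ ≡ α + β * toℚ (count P) ⊎ blockSum P x ≡ 0ℚ
    top-or-balanced with blockSum P x ℚ.≟ 0ℚ
    ... | yes S≡0 = inj₂ S≡0
    ... | no  S≢0 = inj₁ (*-cancelʳ-≢0 (blockSum P x) S≢0 block-trace)

    private
      shifted : ∀ {i} → P i ≡ true → x i * (μ - α) ≡ β * blockSum P x
      shifted {i} Pi = begin
        x i * (μ - α)                    ≡⟨ solve 3 (λ y m a → y :* (m :- a) := m :* y :- a :* y) refl (x i) μ α ⟩
        μ * x i - α * x i                ≡⟨ cong (_- α * x i) (equation i Pi) ⟩
        α * x i + β * blockSum P x - α * x i ≡⟨ solve 2 (λ u v → u :+ v :- u := v) refl (α * x i) _ ⟩
        β * blockSum P x                 ∎

    block-constant : μ ≢ α ⊎ count P ≡ 1 → ∀ {i j} → P i ≡ true → P j ≡ true → x i ≡ x j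
    block-constant (inj₁ μ≢α)     Pi Pj = *-cancelʳ-≢0 (μ - α) (μ≢α ∘ p-q≡0⇒p≡q) (trans (shifted Pi) (sym (shifted Pj)))
    block-constant (inj₂ count≡1) Pi Pj = cong x (count≡1⇒unique P count≡1 Pi Pj)

    block-eigenvalue : ∀ {i} → P i ≡ true → x i ≢ 0ℚ → μ ≡ α + β * toℚ (count P) ⊎ (μ ≡ α × 1 < count P)
    block-eigenvalue {i} Pi xi≢0 with top-or-balanced
    ... | inj₁ top = inj₁ top
    ... | inj₂ S≡0 = inj₂ (μ≡α , ℕ.≤∧≢⇒< (witness⇒count>0 P Pi) (λ 1≡count → xi≢0 (trans (sym (blockSum-singleton P x (sym 1≡count) Pi)) S≡0)))
      where
      μ≡α : μ ≡ α
      μ≡α = *-cancelʳ-≢0 (x i) xi≢0 (begin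
        μ * x i                      ≡⟨ equation i Pi ⟩
        α * x i + β * blockSum P x   ≡⟨ cong (λ s → α * x i + β * s) S≡0 ⟩
        α * x i + β * 0ℚ             ≡⟨ trans (cong (α * x i +_) (ℚ.*-zeroʳ β)) (ℚ.+-identityʳ (α * x i)) ⟩
        α * x i                      ∎)

module CommonNeighbourMatrices where
  open import Data.Nat.Base as ℕ using (suc)
  open import Data.Rational.Base using (ℚ; 0ℚ; _+_; _*_)
  import Data.Rational.Properties as ℚ
  open Counting
  open Rationals
  open ≡-Reasoning

  rowSum-diagonal : ∀ {p} (G : Graph p) i → rowSum G i ℕ.+ commonNbrs G i i ≡ Σℕ p (commonNbrs G i)
  rowSum-diagonal G i = Σℕ-replace i 0 (commonNbrs G i)

  CNSL-action : ∀ {p} (G : Graph p) (x : Fin p → ℚ) i →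
    mulVec (CNSL G) x i + toℚ (commonNbrs G i i) * x i
      ≡ toℚ (rowSum G i) * x i + Σℚ p (λ j → toℚ (commonNbrs G i j) * x j)
  CNSL-action {p} G x i = begin
    mulVec (CNSL G) x i + toℚ (cn i i) * x i
      ≡⟨ cong (_+ toℚ (cn i i) * x i) (trans (Σℚ-cong (λ j → ℚ.*-distribʳ-+ (x j) (CNRS G i j) (CN G i j)))
                                             (Σℚ-+ (λ j → CNRS G i j * x j) (λ j → CN G i j * x j))) ⟩
    Σℚ p (λ j → CNRS G i j * x j) + Σℚ p (λ j → CN G i j * x j) + toℚ (cn i i) * x i
      ≡⟨ ℚ.+-assoc (Σℚ p (λ j → CNRS G i j * x j)) _ _ ⟩
    Σℚ p (λ j → CNRS G i j * x j) + (Σℚ p (λ j → CN G i j * x j) + toℚ (cn i i) * x i)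
      ≡⟨ cong₂ _+_ diagonal off-diagonal ⟩
    toℚ (rowSum G i) * x i + Σℚ p (λ j → toℚ (cn i j) * x j) ∎
    where
    cn = commonNbrs G
    diagonal : Σℚ p (λ j → CNRS G i j * x j) ≡ toℚ (rowSum G i) * x i
    diagonal = trans (Σℚ-cong (λ j → if-0-* (does (i ≟ j)) (toℚ (rowSum G i)) (x j)))
                     (Σℚ-δ i (λ j → toℚ (rowSum G i) * x j))
    cast-if : ∀ b n y → toℚ (if b then 0 else n) * y ≡ (if b then 0ℚ else toℚ n * y)
    cast-if true  n y = ℚ.*-zeroˡ y
    cast-if false n y = refl
    off-diagonal : Σℚ p (λ j → CN G i j * x j) + toℚ (cn i i) * x i ≡ Σℚ p (λ j → toℚ (cn i j) * x j)
    off-diagonal = trans (cong (_+ toℚ (cn i i) * x i) (Σℚ-cong (λ j → cast-if (does (i ≟ j)) (cn i j) (x j))))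
                         (Σℚ-offdiag i (λ j → toℚ (cn i j) * x j))

  meanTr-rowSums : ∀ {k} (G : Graph (suc k)) → meanTr G ≡ toℚ (Σℕ (suc k) (rowSum G)) * recip k
  meanTr-rowSums {k} G = cong (_* recip k) (trans (Σℚ-cong diagonal) (sym (toℚ-Σ (rowSum G))))
    where
    diagonal : ∀ i → CNRS G i i ≡ toℚ (rowSum G i)
    diagonal i with i ≟ i
    ... | yes _   = refl
    ... | no i≢i = ⊥-elim (i≢i refl)

module CompleteGraph (q : ℕ) where
  open import Data.Nat.Base as ℕ using (ℕ; zero; suc)
  import Data.Nat.Properties as ℕ
  open import Data.Nat.Tactic.RingSolver using (solve-∀)
  open import Data.Fin.Properties using (any?)
  open import Data.Rational.Base using (ℚ; 0ℚ; 1ℚ; _+_; _*_; _-_; -_; ∣_∣; _≤_)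
  import Data.Rational.Properties as ℚ
  open import Data.Rational.Solver using (module +-*-Solver)
  open +-*-Solver using (solve; _:+_; _:*_; _:=_; con)
  open import Algebra.Properties.Group ℚ.+-0-group using (inverseˡ-unique)
  open Counting
  open DeviationBudget using (completeEnergy)
  open Rationals
  open LinearDependence
  open RankOneBlock
  open CommonNeighbourMatrices

  p : ℕ
  p = 2 ℕ.+ q

  private
    bit-neq-∧ : ∀ (i k : Fin p) b → bit (neq i k ∧ b) ≡ (if does (i ≟ k) then 0 else bit b)
    bit-neq-∧ i k b with does (i ≟ k)
    ... | true  = refl
    ... | false = refl

    bit-neq : ∀ (i k : Fin p) → bit (neq i k) ≡ (if does (i ≟ k) then 0 else 1)
    bit-neq i k with does (i ≟ k)
    ... | true  = refl
    ... | false = refl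

    neq-≢ : ∀ {i j : Fin p} → i ≢ j → neq i j ≡ true
    neq-≢ {i} {j} i≢j with i ≟ j
    ... | yes i≡j = ⊥-elim (i≢j i≡j)
    ... | no _    = refl

  commonNbrs-K : ∀ i j → commonNbrs (K p) i j ℕ.+ bit (neq j i) ℕ.+ 1 ≡ p
  commonNbrs-K i j = begin
    commonNbrs (K p) i j ℕ.+ bit (neq j i) ℕ.+ 1
      ≡⟨ cong (λ s → s ℕ.+ bit (neq j i) ℕ.+ 1) (Σℕ-cong (λ k → bit-neq-∧ i k (neq j k))) ⟩
    Σℕ p (λ k → if does (i ≟ k) then 0 else bit (neq j k)) ℕ.+ bit (neq j i) ℕ.+ 1
      ≡⟨ cong (ℕ._+ 1) (Σℕ-replace i 0 (bit ∘ neq j)) ⟩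
    Σℕ p (bit ∘ neq j) ℕ.+ 1
      ≡⟨ cong (ℕ._+ 1) (Σℕ-cong (bit-neq j)) ⟩
    Σℕ p (λ k → if does (j ≟ k) then 0 else 1) ℕ.+ 1
      ≡⟨ Σℕ-replace j 0 (λ _ → 1) ⟩
    Σℕ p (λ _ → 1)
      ≡⟨ count-true p ⟩
    p ∎
    where open ≡-Reasoning

  commonNbrs-K-self : ∀ i → commonNbrs (K p) i i ≡ suc q
  commonNbrs-K-self i = ℕ.suc-injective (begin
    suc (commonNbrs (K p) i i)                   ≡⟨ ℕ.+-comm 1 _ ⟩
    commonNbrs (K p) i i ℕ.+ 1                   ≡⟨ cong (ℕ._+ 1) (ℕ.+-identityʳ _) ⟨
    commonNbrs (K p) i i ℕ.+ 0 ℕ.+ 1             ≡⟨ cong (λ b → commonNbrs (K p) i i ℕ.+ bit b ℕ.+ 1) (neq-irrefl i) ⟨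
    commonNbrs (K p) i i ℕ.+ bit (neq i i) ℕ.+ 1 ≡⟨ commonNbrs-K i i ⟩
    p                                            ∎)
    where open ≡-Reasoning

  commonNbrs-K-other : ∀ {i j} → i ≢ j → commonNbrs (K p) i j ≡ q
  commonNbrs-K-other {i} {j} i≢j = ℕ.suc-injective (ℕ.suc-injective (begin
    suc (suc (commonNbrs (K p) i j))              ≡⟨ ℕ.+-comm 2 _ ⟩
    commonNbrs (K p) i j ℕ.+ 2                    ≡⟨ ℕ.+-assoc _ 1 1 ⟨
    commonNbrs (K p) i j ℕ.+ 1 ℕ.+ 1              ≡⟨ cong (λ b → commonNbrs (K p) i j ℕ.+ bit b ℕ.+ 1) (neq-≢ (i≢j ∘ sym)) ⟨
    commonNbrs (K p) i j ℕ.+ bit (neq j i) ℕ.+ 1  ≡⟨ commonNbrs-K i j ⟩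
    p                                             ∎))
    where open ≡-Reasoning

  commonNbrs-K-cases : ∀ i j → commonNbrs (K p) i j ≡ (if does (i ≟ j) then suc q else q)
  commonNbrs-K-cases i j with i ≟ j
  ... | yes refl = commonNbrs-K-self i
  ... | no i≢j   = commonNbrs-K-other i≢j

  rowSum-K : ∀ i → rowSum (K p) i ≡ suc q ℕ.* q
  rowSum-K i = ℕ.+-cancelʳ-≡ q _ _ (begin
    rowSum (K p) i ℕ.+ q                                   ≡⟨ cong (ℕ._+ q) (Σℕ-cong off-diagonal) ⟩
    Σℕ p (λ j → if does (i ≟ j) then 0 else q) ℕ.+ q       ≡⟨ Σℕ-replace i 0 (λ _ → q) ⟩
    Σℕ p (λ _ → q)                                         ≡⟨ Σℕ-const p q ⟩
    q ℕ.+ suc q ℕ.* q                                      ≡⟨ ℕ.+-comm q _ ⟩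
    suc q ℕ.* q ℕ.+ q                                      ∎)
    where
    open ≡-Reasoning
    off-diagonal : ∀ j → CNℕ (K p) i j ≡ (if does (i ≟ j) then 0 else q)
    off-diagonal j with i ≟ j
    ... | yes _   = refl
    ... | no i≢j = commonNbrs-K-other i≢j

  topEigenvalue lowEigenvalue : ℕ
  topEigenvalue = 2 ℕ.* suc q ℕ.* q
  lowEigenvalue = q ℕ.* q

  K-blockEigenvector : ∀ {x θ} → (∀ i → mulVec (CNSL (K p)) x i ≡ θ * x i) →
    IsBlockEigenvector (λ _ → true) x (θ + toℚ (suc q)) (toℚ (suc (suc q ℕ.* q))) (toℚ q)
  K-blockEigenvector {x} {θ} eigen = block-equation equation
    where
    equation : ∀ i → true ≡ true → (θ + toℚ (suc q)) * x i ≡ toℚ (suc (suc q ℕ.* q)) * x i + toℚ q * Σℚ p x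
    equation i _ = begin
      (θ + toℚ (suc q)) * x i
        ≡⟨ ℚ.*-distribʳ-+ (x i) θ (toℚ (suc q)) ⟩
      θ * x i + toℚ (suc q) * x i
        ≡⟨ cong₂ (λ u c → u + toℚ c * x i) (eigen i) (commonNbrs-K-self i) ⟨
      mulVec (CNSL (K p)) x i + toℚ (commonNbrs (K p) i i) * x i
        ≡⟨ CNSL-action (K p) x i ⟩
      toℚ (rowSum (K p) i) * x i + Σℚ p (λ j → toℚ (commonNbrs (K p) i j) * x j)
        ≡⟨ cong₂ (λ r s → toℚ r * x i + s) (rowSum-K i) neighbour-sum ⟩
      toℚ (suc q ℕ.* q) * x i + (toℚ q * S + x i)
        ≡⟨ solve 4 (λ r y c s → r :* y :+ (c :* s :+ y) := (con 1ℚ :+ r) :* y :+ c :* s) refl (toℚ (suc q ℕ.* q)) (x i) (toℚ q) S ⟩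
      (1ℚ + toℚ (suc q ℕ.* q)) * x i + toℚ q * S
        ≡⟨ cong (λ r → r * x i + toℚ q * S) (toℚ-+ 1 (suc q ℕ.* q)) ⟨
      toℚ (suc (suc q ℕ.* q)) * x i + toℚ q * S ∎
      where
      open ≡-Reasoning
      S = Σℚ p x
      term : ∀ b y → toℚ (if b then suc q else q) * y ≡ toℚ q * y + (if b then y else 0ℚ)
      term true  y = trans (cong (_* y) (toℚ-+ 1 q)) (solve 2 (λ c y → (con 1ℚ :+ c) :* y := c :* y :+ y) refl (toℚ q) y)
      term false y = sym (ℚ.+-identityʳ (toℚ q * y))
      neighbour-sum : Σℚ p (λ j → toℚ (commonNbrs (K p) i j) * x j) ≡ toℚ q * S + x i
      neighbour-sum =
        trans (Σℚ-cong (λ j → trans (cong (λ c → toℚ c * x j) (commonNbrs-K-cases i j)) (term (does (i ≟ j)) (x j))))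
              (trans (Σℚ-+ (λ j → toℚ q * x j) (λ j → if does (i ≟ j) then x j else 0ℚ))
                     (cong₂ _+_ (Σℚ-*ˡ (toℚ q) x) (Σℚ-δ i x)))

  private
    top-value : ∀ {θ} → θ + toℚ (suc q) ≡ toℚ (suc (suc q ℕ.* q)) + toℚ q * toℚ (count {p} (λ _ → true)) →
      θ ≡ toℚ topEigenvalue
    top-value eq = +-cancelʳ-toℚ (suc q) topEigenvalue
      (trans eq (trans (cong (λ c → toℚ (suc (suc q ℕ.* q)) + toℚ q * toℚ c) (count-true p))
                       (sym (trans (toℚ-+ (suc (suc q ℕ.* q)) (q ℕ.* p)) (cong (toℚ (suc (suc q ℕ.* q)) +_) (toℚ-* q p))))))
      (identity q)
      where
      identity : ∀ q → 2 ℕ.* (1 ℕ.+ q) ℕ.* q ℕ.+ (1 ℕ.+ q) ≡ (1 ℕ.+ (1 ℕ.+ q) ℕ.* q) ℕ.+ q ℕ.* (2 ℕ.+ q)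
      identity = solve-∀

    low-value : ∀ {θ} → θ + toℚ (suc q) ≡ toℚ (suc (suc q ℕ.* q)) → θ ≡ toℚ lowEigenvalue
    low-value eq = +-cancelʳ-toℚ (suc q) lowEigenvalue eq (identity q)
      where
      identity : ∀ q → q ℕ.* q ℕ.+ (1 ℕ.+ q) ≡ 1 ℕ.+ (1 ℕ.+ q) ℕ.* q
      identity = solve-∀

  K-eigenvalue : ∀ {x θ} → (∀ i → mulVec (CNSL (K p)) x i ≡ θ * x i) → ∀ {i} → x i ≢ 0ℚ →
    θ ≡ toℚ topEigenvalue ⊎ θ ≡ toℚ lowEigenvalue
  K-eigenvalue {x} {θ} eigen {i} xi≢0 =
    Sum.map top-value (low-value ∘ proj₁) (block-eigenvalue (K-blockEigenvector {x} {θ} eigen) {i} refl xi≢0)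

  K-top-exists : ∀ {τ W} → IsEigenbasis (CNSL (K p)) τ W → ∃ λ k → τ k ≡ toℚ topEigenvalue
  K-top-exists {τ} {W} eb = top-or-absurd (any? (λ k → τ k ℚ.≟ toℚ topEigenvalue))
    where
    top-or-absurd : Dec (∃ λ k → τ k ≡ toℚ topEigenvalue) → ∃ λ k → τ k ≡ toℚ topEigenvalue
    top-or-absurd (yes found) = found
    top-or-absurd (no none)   = ⊥-elim (ℕ.1+n≰n (subst (ℕ._≤ suc q) (count-true p)
                                  (count≤dim {V = W} (indep eb) (λ _ → true) (λ k i → W k (suc i)) lift)))
      where
      balanced : ∀ k → Σℚ p (W k) ≡ 0ℚ
      balanced k = Sum.[ (λ top → ⊥-elim (none (k , top-value top))) , (λ W≡0 → W≡0) ]′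
                     (top-or-balanced (K-blockEigenvector {W k} {τ k} (eigen eb k)))
      lift : ∀ c → SupportedOn (λ _ → true) c → IsLinearRelation c (λ k i → W k (suc i)) → IsLinearRelation c W
      lift c _ relation (suc i) = relation i
      lift c _ relation zero    = begin
        Σℚ p (λ k → c k * W k zero)                           ≡⟨ Σℚ-cong (λ k → cong (c k *_) (inverseˡ-unique (W k zero) _ (balanced k))) ⟩
        Σℚ p (λ k → c k * - Σℚ (suc q) (λ i → W k (suc i)))   ≡⟨ Σℚ-cong (λ k → trans (sym (ℚ.neg-distribʳ-* (c k) _))
                                                                                       (cong -_ (sym (Σℚ-*ˡ (c k) (λ i → W k (suc i)))))) ⟩
        Σℚ p (λ k → - Σℚ (suc q) (λ i → c k * W k (suc i)))   ≡⟨ Σℚ-neg (λ k → Σℚ (suc q) (λ i → c k * W k (suc i))) ⟩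
        - Σℚ p (λ k → Σℚ (suc q) (λ i → c k * W k (suc i)))   ≡⟨ cong -_ (Σℚ-swap (λ k i → c k * W k (suc i))) ⟩
        - Σℚ (suc q) (λ i → Σℚ p (λ k → c k * W k (suc i)))   ≡⟨ cong -_ (trans (Σℚ-cong relation) (Σℚ-0 (suc q))) ⟩
        - 0ℚ                                                  ≡⟨⟩
        0ℚ                                                    ∎
        where open ≡-Reasoning

  K-mean : meanTr (K p) ≡ toℚ (p ℕ.* (suc q ℕ.* q)) * recip (suc q)
  K-mean = trans (meanTr-rowSums (K p)) (cong (λ t → toℚ t * recip (suc q)) (trans (Σℕ-cong rowSum-K) (Σℕ-const p (suc q ℕ.* q))))

  top-deviation : ∣ toℚ topEigenvalue - meanTr (K p) ∣ ≡ toℚ (p ℕ.* (suc q ℕ.* q)) * recip (suc q)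
  top-deviation = trans (cong (λ μ → ∣ toℚ topEigenvalue - μ ∣) K-mean)
    (trans (deviation-scaled (suc q) topEigenvalue (p ℕ.* (suc q ℕ.* q)))
           (cong (λ d → toℚ d * recip (suc q)) (m≡n+o⇒∣m-n∣≡o {topEigenvalue ℕ.* p} (p ℕ.* (suc q ℕ.* q)) (identity q))))
    where
    identity : ∀ q → 2 ℕ.* (1 ℕ.+ q) ℕ.* q ℕ.* (2 ℕ.+ q) ≡ (2 ℕ.+ q) ℕ.* ((1 ℕ.+ q) ℕ.* q) ℕ.+ (2 ℕ.+ q) ℕ.* ((1 ℕ.+ q) ℕ.* q)
    identity = solve-∀

  low-deviation : ∣ toℚ lowEigenvalue - meanTr (K p) ∣ ≡ toℚ (p ℕ.* q) * recip (suc q)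
  low-deviation = trans (cong (λ μ → ∣ toℚ lowEigenvalue - μ ∣) K-mean)
    (trans (deviation-scaled (suc q) lowEigenvalue (p ℕ.* (suc q ℕ.* q)))
           (cong (λ d → toℚ d * recip (suc q)) (n≡m+o⇒∣m-n∣≡o {lowEigenvalue ℕ.* p} (p ℕ.* q) (identity q))))
    where
    identity : ∀ q → (2 ℕ.+ q) ℕ.* ((1 ℕ.+ q) ℕ.* q) ≡ q ℕ.* q ℕ.* (2 ℕ.+ q) ℕ.+ (2 ℕ.+ q) ℕ.* q
    identity = solve-∀

  energy≤LEplus-K : ∀ τ W → IsEigenbasis (CNSL (K p)) τ W → toℚ (completeEnergy q) ≤ LEplus (K p) τ
  energy≤LEplus-K τ W eb = from-top (K-top-exists eb)
    where
    from-top : (∃ λ k → τ k ≡ toℚ topEigenvalue) → toℚ (completeEnergy q) ≤ LEplus (K p) τ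
    from-top (k₀ , τk₀≡top) = begin
        toℚ (completeEnergy q)                       ≡⟨ toℚ-*-recip (suc q) (completeEnergy q) ⟨
        toℚ (p ℕ.* completeEnergy q) * recip (suc q) ≡⟨ cong (λ s → toℚ s * recip (suc q)) energy-sum ⟨
        toℚ (Σℕ p bound) * recip (suc q)             ≡⟨ trans (cong (_* recip (suc q)) (toℚ-Σ bound)) (sym (Σℚ-*ʳ (recip (suc q)) (toℚ ∘ bound))) ⟩
        Σℚ p (λ k → toℚ (bound k) * recip (suc q))  ≤⟨ Σℚ-mono-≤ below ⟩
        LEplus (K p) τ                               ∎
        where
        open ℚ.≤-Reasoning
        bound : Fin p → ℕ
        bound k = if does (k₀ ≟ k) then p ℕ.* (suc q ℕ.* q) else p ℕ.* q
        energy-sum : Σℕ p bound ≡ p ℕ.* completeEnergy q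
        energy-sum = ℕ.+-cancelʳ-≡ (p ℕ.* q) _ _ (trans (Σℕ-replace k₀ (p ℕ.* (suc q ℕ.* q)) (λ _ → p ℕ.* q))
          (trans (cong (p ℕ.* (suc q ℕ.* q) ℕ.+_) (Σℕ-const p (p ℕ.* q))) (identity q)))
          where
          identity : ∀ q → (2 ℕ.+ q) ℕ.* ((1 ℕ.+ q) ℕ.* q) ℕ.+ (2 ℕ.+ q) ℕ.* ((2 ℕ.+ q) ℕ.* q)
                   ≡ (2 ℕ.+ q) ℕ.* (2 ℕ.* (1 ℕ.+ q) ℕ.* q) ℕ.+ (2 ℕ.+ q) ℕ.* q
          identity = solve-∀
        low≤top : toℚ (p ℕ.* q) * recip (suc q) ≤ toℚ (p ℕ.* (suc q ℕ.* q)) * recip (suc q)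
        low≤top = *recip-mono-≤ (suc q) (ℕ.*-monoʳ-≤ p (ℕ.m≤m+n q (q ℕ.* q)))
        deviation≥ : ∀ {k} → τ k ≡ toℚ topEigenvalue ⊎ τ k ≡ toℚ lowEigenvalue → toℚ (p ℕ.* q) * recip (suc q) ≤ ∣ τ k - meanTr (K p) ∣
        deviation≥ (inj₁ top) = subst (toℚ (p ℕ.* q) * recip (suc q) ≤_)
                                  (sym (trans (cong (λ t → ∣ t - meanTr (K p) ∣) top) top-deviation)) low≤top
        deviation≥ (inj₂ low) = ℚ.≤-reflexive (sym (trans (cong (λ t → ∣ t - meanTr (K p) ∣) low) low-deviation))
        below′ : ∀ k (k₀≟k : Dec (k₀ ≡ k)) →
          toℚ (if does k₀≟k then p ℕ.* (suc q ℕ.* q) else p ℕ.* q) * recip (suc q) ≤ ∣ τ k - meanTr (K p) ∣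
        below′ k (yes refl) = ℚ.≤-reflexive (sym (trans (cong (λ t → ∣ t - meanTr (K p) ∣) τk₀≡top) top-deviation))
        below′ k (no _)     = deviation≥ (K-eigenvalue (eigen eb k) (proj₂ (LinIndep⇒nonzero {V = W} (indep eb) k)))
        below : ∀ k → toℚ (bound k) * recip (suc q) ≤ ∣ τ k - meanTr (K p) ∣
        below k = below′ k (k₀ ≟ k)

module CompleteBipartiteGraph (m′ n′ : ℕ) where
  open import Data.Nat.Base as ℕ using (ℕ; zero; suc)
  import Data.Nat.Properties as ℕ
  open import Data.Nat.Tactic.RingSolver using (solve-∀)
  open import Data.Rational.Base using (ℚ; 0ℚ; _+_; _*_; _-_; ∣_∣; _≤_)
  import Data.Rational.Properties as ℚ
  open import Relation.Nullary.Decidable using (_×-dec_)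
  open Counting
  open DeviationBudget using (Budget; budget; deviation; completeEnergy)
  open Rationals
  open LinearDependence
  open RankOneBlock
  open CommonNeighbourMatrices

  m n p : ℕ
  m = suc m′
  n = suc n′
  p = m ℕ.+ n

  private
    side-↑ˡ : ∀ {a b} (i : Fin a) → side {a} {b} (i ↑ˡ b) ≡ true
    side-↑ˡ {suc a} zero    = refl
    side-↑ˡ {suc a} (suc i) = side-↑ˡ {a} i

    side-↑ʳ : ∀ {a b} (j : Fin b) → side {a} {b} (a ↑ʳ j) ≡ false
    side-↑ʳ {zero}  j = refl
    side-↑ʳ {suc a} j = side-↑ʳ {a} j

  Σℕ-by-side : ∀ (f : Bool → ℕ) → Σℕ p (f ∘ side {m} {n}) ≡ m ℕ.* f true ℕ.+ n ℕ.* f false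
  Σℕ-by-side f = trans (Σℕ-↑ m n (f ∘ side {m} {n}))
    (cong₂ ℕ._+_ (trans (Σℕ-cong (λ i → cong f (side-↑ˡ {m} {n} i))) (Σℕ-const m (f true)))
                 (trans (Σℕ-cong (λ j → cong f (side-↑ʳ {m} {n} j))) (Σℕ-const n (f false))))

  partOf : Bool → Bool → Bool
  partOf true  b = b
  partOf false b = not b

  part : Bool → Fin p → Bool
  part s i = partOf s (side {m} {n} i)

  size′ other : Bool → ℕ
  size′ true  = m′
  size′ false = n′
  other true  = n
  other false = m

  partOf-self : ∀ s → partOf s s ≡ true
  partOf-self true  = refl
  partOf-self false = refl

  part-side : ∀ s i → part s i ≡ true → side {m} {n} i ≡ s
  part-side true  i i∈s = i∈s
  part-side false i i∈s with side {m} {n} i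
  ... | false = refl

  count-part : ∀ s → count (part s) ≡ suc (size′ s)
  count-part true  = trans (Σℕ-by-side (bit ∘ partOf true))
                           (trans (cong₂ ℕ._+_ (ℕ.*-identityʳ m) (ℕ.*-zeroʳ n)) (ℕ.+-identityʳ m))
  count-part false = trans (Σℕ-by-side (bit ∘ partOf false)) (cong₂ ℕ._+_ (ℕ.*-zeroʳ m) (ℕ.*-identityʳ n))

  commonNbrs-Kbip : ∀ i j → commonNbrs (Kbip m n) i j ≡ bit (part (side {m} {n} i) j) ℕ.* other (side {m} {n} i)
  commonNbrs-Kbip i j = trans (Σℕ-by-side (λ b → bit ((side {m} {n} i xor b) ∧ (side {m} {n} j xor b))))
                              (by-sides (side {m} {n} i) (side {m} {n} j))
    where
    by-sides : ∀ a c → m ℕ.* bit ((a xor true) ∧ (c xor true)) ℕ.+ n ℕ.* bit ((a xor false) ∧ (c xor false))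
                     ≡ bit (partOf a c) ℕ.* other a
    by-sides true  true  = trans (cong₂ ℕ._+_ (ℕ.*-zeroʳ m) (ℕ.*-identityʳ n)) (sym (ℕ.*-identityˡ n))
    by-sides true  false = cong₂ ℕ._+_ (ℕ.*-zeroʳ m) (ℕ.*-zeroʳ n)
    by-sides false true  = cong₂ ℕ._+_ (ℕ.*-zeroʳ m) (ℕ.*-zeroʳ n)
    by-sides false false = trans (cong₂ ℕ._+_ (ℕ.*-identityʳ m) (ℕ.*-zeroʳ n))
                                 (trans (ℕ.+-identityʳ m) (sym (ℕ.*-identityˡ m)))

  commonNbrs-part : ∀ s i j → side {m} {n} i ≡ s → commonNbrs (Kbip m n) i j ≡ bit (part s j) ℕ.* other s
  commonNbrs-part s i j refl = commonNbrs-Kbip i j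

  rowSum-Kbip : ∀ s i → side {m} {n} i ≡ s → rowSum (Kbip m n) i ≡ size′ s ℕ.* other s
  rowSum-Kbip s i side≡s = ℕ.+-cancelʳ-≡ (other s) _ _ (begin
    rowSum (Kbip m n) i ℕ.+ other s
      ≡⟨ cong (rowSum (Kbip m n) i ℕ.+_) (ℕ.*-identityˡ (other s)) ⟨
    rowSum (Kbip m n) i ℕ.+ 1 ℕ.* other s
      ≡⟨ cong (λ b → rowSum (Kbip m n) i ℕ.+ bit b ℕ.* other s) (trans (cong (partOf s) side≡s) (partOf-self s)) ⟨
    rowSum (Kbip m n) i ℕ.+ bit (part s i) ℕ.* other s
      ≡⟨ cong (rowSum (Kbip m n) i ℕ.+_) (commonNbrs-part s i i side≡s) ⟨
    rowSum (Kbip m n) i ℕ.+ commonNbrs (Kbip m n) i i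
      ≡⟨ rowSum-diagonal (Kbip m n) i ⟩
    Σℕ p (commonNbrs (Kbip m n) i)
      ≡⟨ Σℕ-cong (λ j → commonNbrs-part s i j side≡s) ⟩
    Σℕ p (λ j → bit (part s j) ℕ.* other s)
      ≡⟨ Σℕ-*ʳ (bit ∘ part s) (other s) ⟩
    count (part s) ℕ.* other s
      ≡⟨ cong (ℕ._* other s) (count-part s) ⟩
    other s ℕ.+ size′ s ℕ.* other s
      ≡⟨ ℕ.+-comm (other s) _ ⟩
    size′ s ℕ.* other s ℕ.+ other s ∎)
    where open ≡-Reasoning

  Kbip-mean : meanTr (Kbip m n) ≡ toℚ (DeviationBudget.trace m′ n′) * recip (m′ ℕ.+ n)
  Kbip-mean = trans (meanTr-rowSums (Kbip m n)) (cong (λ t → toℚ t * recip (m′ ℕ.+ n))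
    (trans (Σℕ-cong (λ i → rowSum-Kbip (side {m} {n} i) i refl)) (Σℕ-by-side (λ s → size′ s ℕ.* other s))))

  Kbip-deviation : ∀ v → ∣ toℚ v - meanTr (Kbip m n) ∣ ≡ toℚ (deviation m′ n′ v) * recip (m′ ℕ.+ n)
  Kbip-deviation v = trans (cong (λ μ → ∣ toℚ v - μ ∣) Kbip-mean) (deviation-scaled (m′ ℕ.+ n) v (DeviationBudget.trace m′ n′))

  part-blockEigenvector : ∀ {x θ} → (∀ i → mulVec (CNSL (Kbip m n)) x i ≡ θ * x i) → ∀ s →
    IsBlockEigenvector (part s) x (θ + toℚ (other s)) (toℚ (size′ s ℕ.* other s)) (toℚ (other s))
  part-blockEigenvector {x} {θ} eigen s = block-equation equation
    where
    equation : ∀ i → part s i ≡ true →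
      (θ + toℚ (other s)) * x i ≡ toℚ (size′ s ℕ.* other s) * x i + toℚ (other s) * blockSum (part s) x
    equation i i∈s = begin
      (θ + toℚ (other s)) * x i
        ≡⟨ ℚ.*-distribʳ-+ (x i) θ (toℚ (other s)) ⟩
      θ * x i + toℚ (other s) * x i
        ≡⟨ cong₂ (λ u c → u + toℚ c * x i) (eigen i) diagonal ⟨
      mulVec (CNSL (Kbip m n)) x i + toℚ (commonNbrs (Kbip m n) i i) * x i
        ≡⟨ CNSL-action (Kbip m n) x i ⟩
      toℚ (rowSum (Kbip m n) i) * x i + Σℚ p (λ j → toℚ (commonNbrs (Kbip m n) i j) * x j)
        ≡⟨ cong₂ (λ r t → toℚ r * x i + t) (rowSum-Kbip s i side≡s) neighbours ⟩
      toℚ (size′ s ℕ.* other s) * x i + toℚ (other s) * blockSum (part s) x ∎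
      where
      open ≡-Reasoning
      side≡s = part-side s i i∈s
      diagonal : commonNbrs (Kbip m n) i i ≡ other s
      diagonal = trans (commonNbrs-part s i i side≡s) (trans (cong (λ b → bit b ℕ.* other s) i∈s) (ℕ.*-identityˡ (other s)))
      term : ∀ b y → toℚ (bit b ℕ.* other s) * y ≡ toℚ (other s) * (if b then y else 0ℚ)
      term true  y = cong (λ c → toℚ c * y) (ℕ.*-identityˡ (other s))
      term false y = trans (ℚ.*-zeroˡ y) (sym (ℚ.*-zeroʳ (toℚ (other s))))
      neighbours : Σℚ p (λ j → toℚ (commonNbrs (Kbip m n) i j) * x j) ≡ toℚ (other s) * blockSum (part s) x
      neighbours = trans (Σℚ-cong (λ j → trans (cong (λ c → toℚ c * x j) (commonNbrs-part s i j side≡s)) (term (part s j) (x j))))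
                         (Σℚ-*ˡ (toℚ (other s)) (λ j → if part s j then x j else 0ℚ))

  topEigenvalue : Bool → ℕ
  topEigenvalue s = 2 ℕ.* size′ s ℕ.* other s

  private
    top-value : ∀ s {θ} → θ + toℚ (other s) ≡ toℚ (size′ s ℕ.* other s) + toℚ (other s) * toℚ (count (part s)) →
      θ ≡ toℚ (topEigenvalue s)
    top-value s eq = +-cancelʳ-toℚ (other s) (topEigenvalue s)
      (trans eq (trans (cong (λ c → toℚ (size′ s ℕ.* other s) + toℚ (other s) * toℚ c) (count-part s))
        (sym (trans (toℚ-+ (size′ s ℕ.* other s) _) (cong (toℚ (size′ s ℕ.* other s) +_) (toℚ-* (other s) (suc (size′ s))))))))
      (identity (size′ s) (other s))
      where
      identity : ∀ a o → 2 ℕ.* a ℕ.* o ℕ.+ o ≡ a ℕ.* o ℕ.+ o ℕ.* suc a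
      identity = solve-∀

    low-value : ∀ s {θ a} → size′ s ≡ suc a → θ + toℚ (other s) ≡ toℚ (size′ s ℕ.* other s) → θ ≡ toℚ (a ℕ.* other s)
    low-value s {a = a} size≡ eq = +-cancelʳ-toℚ (other s) (a ℕ.* other s) eq
      (trans (ℕ.+-comm (a ℕ.* other s) (other s)) (cong (ℕ._* other s) (sym size≡)))

  open DeviationBudget.Budget (budget m′ n′) using (base; extra; top-A; top-B; low-A; low-B; total)

  top-deviation : ∀ s → deviation m′ n′ (topEigenvalue s) ℕ.≤ base ℕ.+ extra
  top-deviation true  = top-A
  top-deviation false = top-B

  low-deviation : ∀ s {a} → size′ s ≡ suc a → deviation m′ n′ (a ℕ.* other s) ℕ.≤ base
  low-deviation true  = low-A
  low-deviation false = low-B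

  representative : Bool → Fin p
  representative true  = zero
  representative false = m ↑ʳ zero

  representative∈part : ∀ s → part s (representative s) ≡ true
  representative∈part true  = refl
  representative∈part false = cong not (side-↑ʳ {m} {n} zero)

  coordinate : Bool → Fin 2
  coordinate true  = zero
  coordinate false = suc zero

  private
    does-true : ∀ {A : Set} (a? : Dec A) → does a? ≡ true → A
    does-true (yes a) _ = a
    does-true (no _) ()

    does-false : ∀ {A : Set} (a? : Dec A) → does a? ≡ false → ¬ A
    does-false (no ¬a) _ = ¬a
    does-false (yes _) ()

    nor-true : ∀ {x y} → not (x ∨ y) ≡ true → x ≡ false × y ≡ false
    nor-true {false} {false} _ = refl , refl
    nor-true {true}          ()
    nor-true {false} {true}  ()

    nor-false : ∀ {x y} → not (x ∨ y) ≡ false → x ≡ true ⊎ y ≡ true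
    nor-false {true}          _ = inj₁ refl
    nor-false {false} {true}  _ = inj₂ refl
    nor-false {false} {false} ()

    1<suc⇒suc : ∀ {x} → 1 ℕ.< suc x → ∃ λ a → x ≡ suc a
    1<suc⇒suc {zero}  (ℕ.s≤s ())
    1<suc⇒suc {suc a} _ = a , refl

  module _ {σ : Fin p → ℚ} {V : Fin p → Fin p → ℚ} (eb : IsEigenbasis (CNSL (Kbip m n)) σ V) where

    Low : Bool → Fin p → Set
    Low s k = σ k + toℚ (other s) ≡ toℚ (size′ s ℕ.* other s) × 1 ℕ.< count (part s)

    low? : ∀ s k → Dec (Low s k)
    low? s k = (σ k + toℚ (other s) ℚ.≟ toℚ (size′ s ℕ.* other s)) ×-dec (1 ℕ.<? count (part s))

    top : Fin p → Bool
    top k = not (does (low? true k) ∨ does (low? false k))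

    private
      top⇒¬low : ∀ {k} → top k ≡ true → ∀ s → ¬ Low s k
      top⇒¬low {k} top≡ true  = does-false (low? true k)  (proj₁ (nor-true top≡))
      top⇒¬low {k} top≡ false = does-false (low? false k) (proj₂ (nor-true top≡))

      ¬top⇒low : ∀ {k} → top k ≡ false → ∃ λ s → Low s k
      ¬top⇒low {k} top≡ = Sum.[ (λ l → true , does-true (low? true k) l) , (λ l → false , does-true (low? false k) l) ]′
                            (nor-false top≡)

      eigen-part : ∀ k s → IsBlockEigenvector (part s) (V k) (σ k + toℚ (other s)) (toℚ (size′ s ℕ.* other s)) (toℚ (other s))
      eigen-part k s = part-blockEigenvector {V k} {σ k} (eigen eb k) s

    top-constant : ∀ {k} → top k ≡ true → ∀ s {i j} → part s i ≡ true → part s j ≡ true → V k i ≡ V k j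
    top-constant {k} top≡ s = block-constant (eigen-part k s) (not-low (σ k + toℚ (other s) ℚ.≟ toℚ (size′ s ℕ.* other s)))
      where
      not-low : Dec (σ k + toℚ (other s) ≡ toℚ (size′ s ℕ.* other s)) →
        σ k + toℚ (other s) ≢ toℚ (size′ s ℕ.* other s) ⊎ count (part s) ≡ 1
      not-low (no  μ≢α) = inj₁ μ≢α
      not-low (yes μ≡α) = inj₂ (ℕ.≤-antisym (ℕ.≮⇒≥ (λ 1<c → top⇒¬low top≡ s (μ≡α , 1<c)))
                                           (subst (1 ℕ.≤_) (sym (count-part s)) (ℕ.s≤s ℕ.z≤n)))

    top-eigenvalue : ∀ {k} → top k ≡ true → ∃ λ s → σ k ≡ toℚ (topEigenvalue s)
    top-eigenvalue {k} top≡ = from-nonzero (LinIndep⇒nonzero {V = V} (indep eb) k)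
      where
      from-nonzero : (∃ λ i → V k i ≢ 0ℚ) → ∃ λ s → σ k ≡ toℚ (topEigenvalue s)
      from-nonzero (i , Vki≢0) = side {m} {n} i ,
        Sum.[ top-value (side {m} {n} i) , (λ low → ⊥-elim (top⇒¬low top≡ (side {m} {n} i) low)) ]′
          (block-eigenvalue (eigen-part k (side {m} {n} i)) {i} (partOf-self (side {m} {n} i)) Vki≢0)

    low-eigenvalue : ∀ {k} → top k ≡ false → ∃ λ s → ∃ λ a → size′ s ≡ suc a × σ k ≡ toℚ (a ℕ.* other s)
    low-eigenvalue {k} top≡ = from-low (¬top⇒low top≡)
      where
      from-low : (∃ λ s → Low s k) → ∃ λ s → ∃ λ a → size′ s ≡ suc a × σ k ≡ toℚ (a ℕ.* other s)
      from-low (s , μ≡α , 1<count) = finish (1<suc⇒suc (subst (1 ℕ.<_) (count-part s) 1<count))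
        where
        finish : (∃ λ a → size′ s ≡ suc a) → ∃ λ s → ∃ λ a → size′ s ≡ suc a × σ k ≡ toℚ (a ℕ.* other s)
        finish (a , size≡) = s , a , size≡ , low-value s size≡ μ≡α

    sample : Fin p → Fin 2 → ℚ
    sample k zero    = V k (representative true)
    sample k (suc _) = V k (representative false)

    sample-coordinate : ∀ k s → sample k (coordinate s) ≡ V k (representative s)
    sample-coordinate k true  = refl
    sample-coordinate k false = refl

    count-top : count top ℕ.≤ 2
    count-top = count≤dim {V = V} (indep eb) top sample lift
      where
      lift : ∀ c → SupportedOn top c → IsLinearRelation c sample → IsLinearRelation c V
      lift c supported relation j = trans (Σℚ-cong term) (relation (coordinate s))
        where
        s = side {m} {n} j
        term : ∀ k → c k * V k j ≡ c k * sample k (coordinate s)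
        term k = by-flag (top k) refl
          where
          by-flag : ∀ b → top k ≡ b → c k * V k j ≡ c k * sample k (coordinate s)
          by-flag true  top≡ = cong (c k *_) (trans (top-constant top≡ s (partOf-self s) (representative∈part s))
                                                    (sym (sample-coordinate k s)))
          by-flag false top≡ = trans (cong (_* V k j) (supported k top≡)) (trans (ℚ.*-zeroˡ (V k j))
                                 (sym (trans (cong (_* sample k (coordinate s)) (supported k top≡)) (ℚ.*-zeroˡ (sample k (coordinate s))))))

    bound : Fin p → ℕ
    bound k = base ℕ.+ bit (top k) ℕ.* extra

    deviation≤bound : ∀ k → ∣ σ k - meanTr (Kbip m n) ∣ ≤ toℚ (bound k) * recip (m′ ℕ.+ n)
    deviation≤bound k = by-flag (top k) refl
      where
      open ℚ.≤-Reasoning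
      r = recip (m′ ℕ.+ n)
      dev-of : ∀ v → σ k ≡ toℚ v → ∣ σ k - meanTr (Kbip m n) ∣ ≡ toℚ (deviation m′ n′ v) * r
      dev-of v σ≡v = trans (cong (λ t → ∣ t - meanTr (Kbip m n) ∣) σ≡v) (Kbip-deviation v)
      top-case : (∃ λ s → σ k ≡ toℚ (topEigenvalue s)) → ∣ σ k - meanTr (Kbip m n) ∣ ≤ toℚ (base ℕ.+ 1 ℕ.* extra) * r
      top-case (s , σ≡top) = begin
        ∣ σ k - meanTr (Kbip m n) ∣                 ≡⟨ dev-of (topEigenvalue s) σ≡top ⟩
        toℚ (deviation m′ n′ (topEigenvalue s)) * r ≤⟨ *recip-mono-≤ (m′ ℕ.+ n) (top-deviation s) ⟩
        toℚ (base ℕ.+ extra) * r                    ≡⟨ cong (λ e → toℚ (base ℕ.+ e) * r) (ℕ.*-identityˡ extra) ⟨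
        toℚ (base ℕ.+ 1 ℕ.* extra) * r              ∎
      low-case : (∃ λ s → ∃ λ a → size′ s ≡ suc a × σ k ≡ toℚ (a ℕ.* other s)) →
        ∣ σ k - meanTr (Kbip m n) ∣ ≤ toℚ (base ℕ.+ 0 ℕ.* extra) * r
      low-case (s , a , size≡ , σ≡low) = begin
        ∣ σ k - meanTr (Kbip m n) ∣                ≡⟨ dev-of (a ℕ.* other s) σ≡low ⟩
        toℚ (deviation m′ n′ (a ℕ.* other s)) * r  ≤⟨ *recip-mono-≤ (m′ ℕ.+ n) (low-deviation s size≡) ⟩
        toℚ base * r                               ≡⟨ cong (λ e → toℚ e * r) (ℕ.+-identityʳ base) ⟨
        toℚ (base ℕ.+ 0 ℕ.* extra) * r             ∎
      by-flag : ∀ b → top k ≡ b → ∣ σ k - meanTr (Kbip m n) ∣ ≤ toℚ (base ℕ.+ bit b ℕ.* extra) * r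
      by-flag true  top≡ = top-case (top-eigenvalue top≡)
      by-flag false top≡ = low-case (low-eigenvalue top≡)

    Σbound≤ : Σℕ p bound ℕ.≤ p ℕ.* base ℕ.+ 2 ℕ.* extra
    Σbound≤ = begin
      Σℕ p bound                                       ≡⟨ Σℕ-+ (λ _ → base) (λ k → bit (top k) ℕ.* extra) ⟩
      Σℕ p (λ _ → base) ℕ.+ Σℕ p (λ k → bit (top k) ℕ.* extra)
        ≡⟨ cong₂ ℕ._+_ (Σℕ-const p base) (Σℕ-*ʳ (bit ∘ top) extra) ⟩
      p ℕ.* base ℕ.+ count top ℕ.* extra               ≤⟨ ℕ.+-monoʳ-≤ (p ℕ.* base) (ℕ.*-monoˡ-≤ extra count-top) ⟩
      p ℕ.* base ℕ.+ 2 ℕ.* extra                       ∎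
      where open ℕ.≤-Reasoning

    LEplus-Kbip≤energy : LEplus (Kbip m n) σ ≤ toℚ (completeEnergy (m′ ℕ.+ n′))
    LEplus-Kbip≤energy = begin
      LEplus (Kbip m n) σ                              ≤⟨ Σℚ-mono-≤ deviation≤bound ⟩
      Σℚ p (λ k → toℚ (bound k) * r)                   ≡⟨ Σℚ-*ʳ r (toℚ ∘ bound) ⟩
      Σℚ p (toℚ ∘ bound) * r                           ≡⟨ cong (_* r) (toℚ-Σ bound) ⟨
      toℚ (Σℕ p bound) * r                             ≤⟨ *recip-mono-≤ (m′ ℕ.+ n) (ℕ.≤-trans Σbound≤ total) ⟩
      toℚ (p ℕ.* completeEnergy (m′ ℕ.+ n′)) * r       ≡⟨ toℚ-*-recip (m′ ℕ.+ n) (completeEnergy (m′ ℕ.+ n′)) ⟩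
      toℚ (completeEnergy (m′ ℕ.+ n′))                 ∎
      where
      open ℚ.≤-Reasoning
      r = recip (m′ ℕ.+ n)

open import Data.Nat.Base using (suc; _+_; _≤_; s≤s)
open import Data.Nat.Properties using (+-suc)
open import Data.Rational.Base using (ℚ) renaming (_≤_ to _≤ℚ_)
open import Data.Rational.Properties using (≤-trans)

proposition3p6 : (m n : ℕ) → 1 ≤ m → 1 ≤ n →
    (σ : Fin (m + n) → ℚ) (V : Fin (m + n) → Fin (m + n) → ℚ) →
    IsEigenbasis (CNSL (Kbip m n)) σ V →
    (τ : Fin (m + n) → ℚ) (W : Fin (m + n) → Fin (m + n) → ℚ) →
    IsEigenbasis (CNSL (K (m + n))) τ W →
    LEplus (Kbip m n) σ ≤ℚ LEplus (K (m + n)) τ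
proposition3p6 (suc m′) (suc n′) (s≤s _) (s≤s _) σ V eb τ W eb′ =
  ≤-trans (CompleteBipartiteGraph.LEplus-Kbip≤energy m′ n′ eb) (complete-lower (cong suc (+-suc m′ n′)) eb′)
  where
  complete-lower : ∀ {p q τ W} → p ≡ 2 + q → IsEigenbasis (CNSL (K p)) τ W →
    toℚ (DeviationBudget.completeEnergy q) ≤ℚ LEplus (K p) τ
  complete-lower {q = q} refl = CompleteGraph.energy≤LEplus-K q _ _
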